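{- For every index $\boldsymbol{k}$ of positive integers with depth $r\ge1$, the following holds in $\widehat{\mathcal{A}}$: \[ \zeta_{\widehat{\mathcal{A}}}(\boldsymbol{k})=(-1)^{r}\sum_{i=0}^{\infty}\ \sum_{\substack{\boldsymbol{l}\in\mathbb{Z}_{\ge0}^{r}\\ \mathrm{wt}(\boldsymbol{l})=i}}\ \sum_{\boldsymbol{l}\oplus\boldsymbol{k}\preceq\boldsymbol{m}\preceq\boldsymbol{l}\oslash\boldsymbol{k}}\zeta_{\widehat{\mathcal{A}}}(\boldsymbol{m})\,\boldsymbol{p}^i, \] the series converging in the $\boldsymbol{p}$-adic topology.
   Context: An index is a finite tuple $\boldsymbol{k}=(k_1,\dots,k_r)$ of positive integers, with depth $r$ and weight $k_1+\cdots+k_r$; for $\boldsymbol{l}=(l_1,\dots,l_r)\in\mathbb{Z}_{\ge0}^r$, $\mathrm{wt}(\boldsymbol{l})=l_1+\cdots+l_r$. Multiple harmonic sum: $\zeta_{<N}(\boldsymbol{k})=\sum_{0<n_1<\cdots<n_r<N}n_1^{ -k_1}\cdots n_r^{ -k_r}$. Let $\mathcal{P}$ be the set of primes and $\widehat{\mathcal{A}}=\varprojlim_n\bigl(\prod_{p\in\mathcal{P}}\mathbb{Z}/p^n\mathbb{Z}\bigr)/\bigl(\bigoplus_{p\in\mathcal{P}}\mathbb{Z}/p^n\mathbb{Z}\bigr)$, with $\boldsymbol{p}=((p\bmod p^n)_{p})_n\in\widehat{\mathcal{A}}$ and the $\boldsymbol{p}$-adic topology. Define $\zeta_{\widehat{\mathcal{A}}}(\boldsymbol{k})=((\zeta_{<p}(\boldsymbol{k})\bmod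 p^n)_{p\in\mathcal{P}})_{n\ge1}$. For indices $\boldsymbol{m},\boldsymbol{k}$, $\boldsymbol{m}\preceq\boldsymbol{k}$ means $\boldsymbol{m}$ is obtained from $\boldsymbol{k}$ by replacing some (possibly none) of the commas by plus signs (e.g. $(5,1)\preceq(2,3,1)$). For $\boldsymbol{k}=(k_1,\dots,k_r)$ and $\boldsymbol{l}=(l_1,\dots,l_r)\in\mathbb{Z}_{\ge0}^r$: $\boldsymbol{l}\oplus\boldsymbol{k}=(l_1+k_1,\dots,l_r+k_r)$ and $\boldsymbol{l}\oslash\boldsymbol{k}=(l_1+1,\{1\}^{k_1-1},\dots,l_r+1,\{1\}^{k_r-1})$, where $\{1\}^a$ denotes $a$ repeated $1$'s. The innermost sum runs over indices $\boldsymbol{m}$ with $\boldsymbol{l}\oplus\boldsymbol{k}\preceq\boldsymbol{m}\preceq\boldsymbol{l}\oslash\boldsymbol{k}$. -}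

module Defs where

open import Data.Nat as ℕ using (ℕ; zero; suc; _∸_; _^_; _<_; _≤_)
open import Data.Nat.Properties using (m^n≢0)
open import Data.Nat.Divisibility using (_∣_)
open import Data.Integer as ℤ using (ℤ; +_; ∣_∣)
open import Data.Rational using (ℚ; 0ℚ; 1ℚ; _+_; _*_; -_; _-_; _/_; ↥_; ↧ₙ_)
open import Data.List using (List; []; _∷_; [_]; map; _++_; concatMap; upTo; zipWith; replicate; concat; filter; length)
open import Data.List.Properties using (≡-dec)
open import Data.List.Membership.DecPropositional (≡-dec ℕ._≟_) using (_∈_; _∈?_)
open import Relation.Nullary using (¬_)
open import Data.Product using (_×_)

-- Indices are lists of positive integers (positivity imposed as hypothesis).
Index : Set
Index = List ℕ

Σℚ : List ℚ → ℚ
Σℚ [] = 0ℚ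
Σℚ (x ∷ xs) = x + Σℚ xs

-- n^{-k} for n = suc m
invPow : ℕ → ℕ → ℚ
invPow m k = (+ 1) / (suc m ^ k)
  where instance _ = m^n≢0 (suc m) k

-- H a N (k₁,…,k_r) = Σ_{a < n₁ < ⋯ < n_r < N} n₁^{-k₁} ⋯ n_r^{-k_r}
H : ℕ → ℕ → Index → ℚ
H a N [] = 1ℚ
H a N (k ∷ ks) =
  Σℚ (map (λ j → invPow (a ℕ.+ j) k * H (suc (a ℕ.+ j)) N ks) (upTo (N ∸ suc a)))

ζ< : ℕ → Index → ℚ
ζ< N k = H 0 N k

sgn : ℕ → ℚ
sgn zero = 1ℚ
sgn (suc r) = - sgn r

ℕ→ℚ : ℕ → ℚ
ℕ→ℚ n = (+ n) / 1

comps : ℕ → ℕ → List (List ℕ)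
comps zero zero = [ [] ]
comps zero (suc _) = []
comps (suc r) i = concatMap (λ j → map (j ∷_) (comps r (i ∸ j))) (upTo (suc i))

_⊕_ : List ℕ → Index → Index
l ⊕ k = zipWith ℕ._+_ l k

_⊘_ : List ℕ → Index → Index
l ⊘ k = concat (zipWith (λ a b → suc a ∷ replicate (b ∸ 1) 1) l k)

addHead : ℕ → List ℕ → List ℕ
addHead x [] = [ x ]
addHead x (z ∷ zs) = (x ℕ.+ z) ∷ zs

-- all indices obtained from k by replacing some (possibly none) commas by plus signs
coarsenings : Index → List Index
coarsenings [] = [ [] ]
coarsenings (x ∷ []) = [ [ x ] ]
coarsenings (x ∷ y ∷ ys) =
  map (x ∷_) (coarsenings (y ∷ ys)) ++ map (addHead x) (coarsenings (y ∷ ys))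

_⪯_ : Index → Index → Set
m ⪯ k = m ∈ coarsenings k

between : List ℕ → Index → List Index
between l k = filter (λ m → (l ⊕ k) ∈? coarsenings m) (coarsenings (l ⊘ k))

coeff : ℕ → Index → ℕ → ℚ
coeff p k i = Σℚ (map (λ l → Σℚ (map (ζ< p) (between l k))) (comps (length k) i))

partialRHS : ℕ → Index → ℕ → ℚ
partialRHS p k N = sgn (length k) * Σℚ (map (λ i → coeff p k i * ℕ→ℚ (p ^ i)) (upTo N))

-- x ≡ y mod p^n in ℤ_(p):  x - y = a/b (reduced) with p^n ∣ a and p ∤ b
CongMod : ℕ → ℕ → ℚ → ℚ → Set
CongMod p n x y = (p ^ n) ∣ ∣ ↥ (x - y) ∣ × ¬ (p ∣ ↧ₙ (x - y))

{-# OPTIONS --safe #-}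
-- Write t(h)(n) = Σ_{n≤m<N} h(m)/m for the harmonic tail and, for k = (k₁, k′),
--   S_N(k)(a) = Σ_{a<n<N} (N−n)⁻¹ · t^{k₁−1}(S_N(k′))(n),   S_N(∅) = 1   (reflectedSum N k a).
-- First, ζ_{<N}(k) = S_N(k)(0) for every N: expanding H(i, N, k′) against the connector
-- κ(i, j) = C(j−1, i−1) / C(N−1, i) turns each factor m^{−k₁} into (N−n)⁻¹ · t^{k₁−1}.
-- Now take N = p prime. For 0 < n < p,
--   (p−n)⁻¹ = −Σ_{j<T} p^j n^{−j−1} + p^T n^{−T} (p−n)⁻¹,
-- and the last term lies in p^T ℤ₍ₚ₎. Substituting this into S_p(k) and unfolding the iterated tails,
-- the non-strict chains m₁ ≤ ⋯ ≤ m_{k₁−1} become strict chains summed over all coarsenings of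
-- (l₁+1, 1^{k₁−1}); these are exactly the m with l ⊕ k ⪯ m ⪯ l ⊘ k. Hence, by induction on the depth,
-- the T-th partial sum Σ_{i<T} (⋯) p^i is congruent to (−1)^r S_p(k)(0) = (−1)^r ζ_{<p}(k) modulo p^T,
-- for every prime p and every T.

module Submission where

open import Defs
open import Data.Nat using (ℕ; _≤_; _<_; _^_)
open import Data.Nat.Primality using (Prime)
open import Data.List using (List; []; _∷_)
open import Data.List.Relation.Unary.All using (All)
open import Data.Product using (Σ)
open import Relation.Nullary using (¬_)
open import Relation.Binary.PropositionalEquality using (_≡_)

open import Algebra.Bundles using (CommutativeRing)
open import Data.Empty using (⊥-elim)
open import Data.Fin using (toℕ)
open import Data.Fin.Properties using (toℕ<n; toℕ-inject₁; toℕ-fromℕ)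
import Data.Integer as ℤ
import Data.Integer.Divisibility.Signed as ℤ∣
import Data.Integer.Properties as ℤ
open import Data.List using ([_]; _++_; applyUpTo; concat; concatMap; filter; length; map; replicate; upTo)
open import Data.List.Membership.Propositional using (_∈_; _∉_)
open import Data.List.Membership.Propositional.Properties using (∈-map⁺; ∈-map⁻; ∈-++⁺ˡ; ∈-++⁺ʳ; ∈-++⁻; map∷-decomp∈)
open import Data.List.Properties
  using (≡-dec; map-cong; map-cong-local; map-∘; map-upTo; map-++; map-concatMap; concatMap-map; concatMap-++;
         filter-++; filter-accept; filter-reject; filter-none; ++-identityʳ; ∷-injectiveˡ)
open import Data.List.Relation.Unary.All as All using ([]; _∷_)
import Data.List.Relation.Unary.All.Properties as Allₚ
open import Data.List.Relation.Unary.Any using (here; there)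
open import Data.Nat as ℕ using (zero; suc; _∸_; z≤n; s≤s)
import Data.Nat.Coprimality as Coprimality
open import Data.Nat.Divisibility
  using (_∣_; divides; ∣-refl; ∣-reflexive; ∣-trans; ∣⇒≤; 1∣_; _∣0; m∣m*n; ∣m⇒∣m*n; ∣n⇒∣m*n; *-monoʳ-∣; *-cancelˡ-∣; *-pres-∣)
open import Data.Nat.Primality using (euclidsLemma; prime⇒nonZero; prime⇒nonTrivial)
import Data.Nat.Properties as ℕ
open import Data.Nat.Tactic.RingSolver using (solve-∀)
open import Data.List.Membership.DecPropositional (≡-dec ℕ._≟_) using (_∈?_)
open import Data.Product using (_,_; _×_; proj₁; proj₂)
open import Data.Rational using (ℚ; 0ℚ; 1ℚ; _+_; _*_; -_; _-_; _/_; toℚᵘ; mkℚ; ↥_; ↧ₙ_)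
import Data.Rational.Properties as ℚ
open import Data.Rational.Solver using (module +-*-Solver)
open import Data.Rational.Unnormalised as ℚᵘ using (mkℚᵘ; *≡*) renaming (_≃_ to _≃ᵘ_)
import Data.Rational.Unnormalised.Properties as ℚᵘ
open import Data.Sum as Sum using (inj₁; inj₂)
open import Function using (_∘_)
open import Function.Bundles using (_⇔_; mk⇔; Equivalence)
open import Relation.Binary.PropositionalEquality using (refl; sym; trans; cong; cong₂; subst; subst₂; module ≡-Reasoning)
open import Relation.Nullary using (yes; no)
open import Relation.Unary using (Decidable)

open import Algebra.Properties.Semiring.Sum (CommutativeRing.semiring ℚ.+-*-commutativeRing)
  using (sum; sum-cong-≗; ∑-distrib-+; ∑-comm; *-distribˡ-sum; sum-init-last; sum-replicate-zero)
open import Algebra.Properties.CommutativeSemigroup (CommutativeRing.*-commutativeSemigroup ℚ.+-*-commutativeRing)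
  using (x∙yz≈y∙xz)
open +-*-Solver

-- Finite sums

sumOver : {A : Set} → List A → (A → ℚ) → ℚ
sumOver xs f = Σℚ (map f xs)

sumOver-++ : ∀ {A : Set} (xs ys : List A) (f : A → ℚ) → sumOver (xs ++ ys) f ≡ sumOver xs f + sumOver ys f
sumOver-++ []       ys f = sym (ℚ.+-identityˡ _)
sumOver-++ (x ∷ xs) ys f = trans (cong (f x +_) (sumOver-++ xs ys f)) (sym (ℚ.+-assoc (f x) _ _))

sumOver-map : ∀ {A B : Set} (g : A → B) (xs : List A) (f : B → ℚ) → sumOver (map g xs) f ≡ sumOver xs (f ∘ g)
sumOver-map g xs f = cong Σℚ (sym (map-∘ xs))

sumOver-concatMap : ∀ {A B : Set} (F : A → List B) (xs : List A) (f : B → ℚ) →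
  sumOver (concatMap F xs) f ≡ sumOver xs (λ x → sumOver (F x) f)
sumOver-concatMap F []       f = refl
sumOver-concatMap F (x ∷ xs) f =
  trans (sumOver-++ (F x) (concatMap F xs) f) (cong (sumOver (F x) f +_) (sumOver-concatMap F xs f))

sumOver-cong : ∀ {A : Set} (xs : List A) {f g : A → ℚ} → (∀ x → f x ≡ g x) → sumOver xs f ≡ sumOver xs g
sumOver-cong xs f≡g = cong Σℚ (map-cong f≡g xs)

sumOver-congᴬ : ∀ {A : Set} {P : A → Set} {xs : List A} {f g : A → ℚ} →
  All P xs → (∀ {x} → P x → f x ≡ g x) → sumOver xs f ≡ sumOver xs g
sumOver-congᴬ pxs f≡g = cong Σℚ (map-cong-local (All.map f≡g pxs))

sumOver-*ˡ : ∀ {A : Set} (xs : List A) c (f : A → ℚ) → sumOver xs (λ x → c * f x) ≡ c * sumOver xs f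
sumOver-*ˡ []       c f = sym (ℚ.*-zeroʳ c)
sumOver-*ˡ (x ∷ xs) c f = trans (cong (c * f x +_) (sumOver-*ˡ xs c f)) (sym (ℚ.*-distribˡ-+ c (f x) _))

-- Opaque, so that the summand can be inferred from sumBelow n f by unification.
opaque
  sumBelow : ℕ → (ℕ → ℚ) → ℚ
  sumBelow n f = sum {n} (f ∘ toℕ)

  sumBelow-cong : ∀ n {f g : ℕ → ℚ} → (∀ j → j < n → f j ≡ g j) → sumBelow n f ≡ sumBelow n g
  sumBelow-cong n f≡g = sum-cong-≗ {n} (λ i → f≡g (toℕ i) (toℕ<n i))

  sumBelow-+ : ∀ n (f g : ℕ → ℚ) → sumBelow n (λ j → f j + g j) ≡ sumBelow n f + sumBelow n g
  sumBelow-+ n f g = ∑-distrib-+ {n} (f ∘ toℕ) (g ∘ toℕ)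

  sumBelow-*ˡ : ∀ n c (f : ℕ → ℚ) → sumBelow n (λ j → c * f j) ≡ c * sumBelow n f
  sumBelow-*ˡ n c f = sym (*-distribˡ-sum {n} c (f ∘ toℕ))

  sumBelow-0ℚ : ∀ n → sumBelow n (λ _ → 0ℚ) ≡ 0ℚ
  sumBelow-0ℚ n = sum-replicate-zero n

  sumBelow-suc : ∀ n (f : ℕ → ℚ) → sumBelow (suc n) f ≡ sumBelow n f + f n
  sumBelow-suc n f = trans (sum-init-last {n} (f ∘ toℕ))
    (cong₂ _+_ (sum-cong-≗ {n} (cong f ∘ toℕ-inject₁)) (cong f (toℕ-fromℕ n)))

  sumBelow-comm : ∀ n m (f : ℕ → ℕ → ℚ) →
    sumBelow n (λ i → sumBelow m (f i)) ≡ sumBelow m (λ j → sumBelow n (λ i → f i j))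
  sumBelow-comm n m f = ∑-comm {n} {m} (λ i j → f (toℕ i) (toℕ j))

  sumBelow-empty : ∀ (f : ℕ → ℚ) → sumBelow 0 f ≡ 0ℚ
  sumBelow-empty f = refl

  sumBelow-split : ∀ n (f : ℕ → ℚ) → sumBelow (suc n) f ≡ f 0 + sumBelow n (f ∘ suc)
  sumBelow-split n f = refl

  sumOver-upTo : ∀ n (f : ℕ → ℚ) → sumOver (upTo n) f ≡ sumBelow n f
  sumOver-upTo n f = trans (cong Σℚ (map-upTo f n)) (Σℚ-applyUpTo f n)
    where
    Σℚ-applyUpTo : ∀ (f : ℕ → ℚ) n → Σℚ (applyUpTo f n) ≡ sumBelow n f
    Σℚ-applyUpTo f zero    = refl
    Σℚ-applyUpTo f (suc n) = cong (f 0 +_) (Σℚ-applyUpTo (f ∘ suc) n)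

  sumBelow-sumOver-comm : ∀ {A : Set} n (xs : List A) (f : A → ℕ → ℚ) →
    sumBelow n (λ i → sumOver xs (λ x → f x i)) ≡ sumOver xs (λ x → sumBelow n (f x))
  sumBelow-sumOver-comm n []       f = sumBelow-0ℚ n
  sumBelow-sumOver-comm n (x ∷ xs) f =
    trans (sumBelow-+ n (f x) (λ i → sumOver xs (λ y → f y i)))
      (cong (sumBelow n (f x) +_) (sumBelow-sumOver-comm n xs f))

sumBelow-*ʳ : ∀ n c (f : ℕ → ℚ) → sumBelow n (λ j → f j * c) ≡ sumBelow n f * c
sumBelow-*ʳ n c f = begin
  sumBelow n (λ j → f j * c) ≡⟨ sumBelow-cong n (λ j _ → ℚ.*-comm (f j) c) ⟩
  sumBelow n (λ j → c * f j) ≡⟨ sumBelow-*ˡ n c f ⟩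
  c * sumBelow n f           ≡⟨ ℚ.*-comm c _ ⟩
  sumBelow n f * c           ∎
  where open ≡-Reasoning

j<N∸[1+a]⇒1+a+j<N : ∀ a N j → j < N ∸ suc a → suc (a ℕ.+ j) < N
j<N∸[1+a]⇒1+a+j<N a       zero    j ()
j<N∸[1+a]⇒1+a+j<N zero    (suc N) j j<N       = s≤s j<N
j<N∸[1+a]⇒1+a+j<N (suc a) (suc N) j j<N∸1+a = s≤s (j<N∸[1+a]⇒1+a+j<N a N j j<N∸1+a)

opaque
  sumBetween : ℕ → ℕ → (ℕ → ℚ) → ℚ
  sumBetween a N f = sumBelow (N ∸ suc a) (λ j → f (suc (a ℕ.+ j)))

  sumBetween-as-sumBelow : ∀ a N (f : ℕ → ℚ) → sumBetween a N f ≡ sumBelow (N ∸ suc a) (λ j → f (suc (a ℕ.+ j)))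
  sumBetween-as-sumBelow a N f = refl

  sumBetween-cong : ∀ a N {f g : ℕ → ℚ} → (∀ m → a < m → m < N → f m ≡ g m) →
    sumBetween a N f ≡ sumBetween a N g
  sumBetween-cong a N f≡g = sumBelow-cong (N ∸ suc a)
    (λ j j< → f≡g _ (s≤s (ℕ.m≤m+n a j)) (j<N∸[1+a]⇒1+a+j<N a N j j<))

  sumBetween-+ : ∀ a N (f g : ℕ → ℚ) →
    sumBetween a N (λ m → f m + g m) ≡ sumBetween a N f + sumBetween a N g
  sumBetween-+ a N f g = sumBelow-+ (N ∸ suc a) _ _

  sumBetween-*ˡ : ∀ a N c (f : ℕ → ℚ) → sumBetween a N (λ m → c * f m) ≡ c * sumBetween a N f
  sumBetween-*ˡ a N c f = sumBelow-*ˡ (N ∸ suc a) c _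

  sumBetween-*ʳ : ∀ a N c (f : ℕ → ℚ) → sumBetween a N (λ m → f m * c) ≡ sumBetween a N f * c
  sumBetween-*ʳ a N c f = sumBelow-*ʳ (N ∸ suc a) c _

  sumBetween-comm : ∀ a N b M (f : ℕ → ℕ → ℚ) →
    sumBetween a N (λ m → sumBetween b M (f m)) ≡ sumBetween b M (λ m′ → sumBetween a N (λ m → f m m′))
  sumBetween-comm a N b M f = sumBelow-comm (N ∸ suc a) (M ∸ suc b) _

  sumBelow-sumBetween-comm : ∀ n a N (f : ℕ → ℕ → ℚ) →
    sumBelow n (λ j → sumBetween a N (f j)) ≡ sumBetween a N (λ m → sumBelow n (λ j → f j m))
  sumBelow-sumBetween-comm n a N f = sumBelow-comm n (N ∸ suc a) _

  sumBetween-empty : ∀ a N (f : ℕ → ℚ) → N ≤ suc a → sumBetween a N f ≡ 0ℚ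
  sumBetween-empty a N f N≤1+a =
    trans (cong (λ n → sumBelow n (λ j → f (suc (a ℕ.+ j)))) (ℕ.m≤n⇒m∸n≡0 N≤1+a)) (sumBelow-empty _)

  sumBetween-suc : ∀ a N (f : ℕ → ℚ) → a < N → sumBetween a (suc N) f ≡ sumBetween a N f + f N
  sumBetween-suc a N f a<N = begin
    sumBelow (N ∸ a) g                                 ≡⟨ cong (λ n → sumBelow n g) (ℕ.+-∸-assoc 1 a<N) ⟩
    sumBelow (suc (N ∸ suc a)) g                       ≡⟨ sumBelow-suc (N ∸ suc a) g ⟩
    sumBelow (N ∸ suc a) g + f (suc a ℕ.+ (N ∸ suc a)) ≡⟨ cong (λ m → sumBetween a N f + f m) (ℕ.m+[n∸m]≡n a<N) ⟩
    sumBetween a N f + f N                             ∎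
    where
    open ≡-Reasoning
    g : ℕ → ℚ
    g j = f (suc (a ℕ.+ j))

  sumBetween-head : ∀ a N (f : ℕ → ℚ) → suc a < N → sumBetween a N f ≡ f (suc a) + sumBetween (suc a) N f
  sumBetween-head a N f 1+a<N = begin
    sumBelow (N ∸ suc a) g                     ≡⟨ cong (λ n → sumBelow n g) (ℕ.+-∸-assoc 1 1+a<N) ⟩
    sumBelow (suc (N ∸ suc (suc a))) g         ≡⟨ trans (sumBelow-split (N ∸ suc (suc a)) g) (cong₂ _+_ (cong (f ∘ suc) (ℕ.+-identityʳ a))
                                                     (sumBelow-cong (N ∸ suc (suc a)) (λ j _ → cong (f ∘ suc) (ℕ.+-suc a j)))) ⟩
    f (suc a) + sumBetween (suc a) N f         ∎
    where
    open ≡-Reasoning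
    g : ℕ → ℚ
    g j = f (suc (a ℕ.+ j))

  sumBetween-sumOver-comm : ∀ {A : Set} a N (xs : List A) (f : A → ℕ → ℚ) →
    sumBetween a N (λ m → sumOver xs (λ x → f x m)) ≡ sumOver xs (λ x → sumBetween a N (f x))
  sumBetween-sumOver-comm a N xs f = sumBelow-sumOver-comm (N ∸ suc a) xs (λ x j → f x (suc (a ℕ.+ j)))

sumBetween-triangle : ∀ N (f g : ℕ → ℚ) →
  sumBetween 0 N (λ j → f j * sumBetween j N g) ≡ sumBetween 0 N (λ m → sumBetween 0 m f * g m)
sumBetween-triangle zero          f g = trans (sumBetween-empty 0 0 _ z≤n) (sym (sumBetween-empty 0 0 _ z≤n))
sumBetween-triangle (suc zero)    f g = trans (sumBetween-empty 0 1 _ ℕ.≤-refl) (sym (sumBetween-empty 0 1 _ ℕ.≤-refl))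
sumBetween-triangle (suc M@(suc _)) f g = begin
    sumBetween 0 (suc M) (λ j → f j * sumBetween j (suc M) g)
  ≡⟨ sumBetween-suc 0 M _ z<M ⟩
    sumBetween 0 M (λ j → f j * sumBetween j (suc M) g) + f M * sumBetween M (suc M) g
  ≡⟨ cong₂ _+_ (sumBetween-cong 0 M (λ j _ j<M → cong (f j *_) (sumBetween-suc j M g j<M)))
               (cong (f M *_) (sumBetween-empty M (suc M) g ℕ.≤-refl)) ⟩
    sumBetween 0 M (λ j → f j * (sumBetween j M g + g M)) + f M * 0ℚ
  ≡⟨ cong₂ _+_ (sumBetween-cong 0 M (λ j _ _ → ℚ.*-distribˡ-+ (f j) _ (g M))) (ℚ.*-zeroʳ (f M)) ⟩
    sumBetween 0 M (λ j → f j * sumBetween j M g + f j * g M) + 0ℚ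
  ≡⟨ trans (ℚ.+-identityʳ _) (sumBetween-+ 0 M _ _) ⟩
    sumBetween 0 M (λ j → f j * sumBetween j M g) + sumBetween 0 M (λ j → f j * g M)
  ≡⟨ cong₂ _+_ (sumBetween-triangle M f g) (sumBetween-*ʳ 0 M (g M) f) ⟩
    sumBetween 0 M (λ m → sumBetween 0 m f * g m) + sumBetween 0 M f * g M
  ≡⟨ sym (sumBetween-suc 0 M _ z<M) ⟩
    sumBetween 0 (suc M) (λ m → sumBetween 0 m f * g m)
  ∎
  where
  open ≡-Reasoning
  z<M : 0 < M
  z<M = s≤s z≤n

sumBelow-antidiagonal : ∀ T (h : ℕ → ℕ → ℚ) →
  sumBelow T (λ i → sumBelow (suc i) (λ j → h j (i ∸ j))) ≡ sumBelow T (λ j → sumBelow (T ∸ j) (h j))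
sumBelow-antidiagonal zero    h = trans (sumBelow-empty _) (sym (sumBelow-empty _))
sumBelow-antidiagonal (suc T) h = begin
    sumBelow (suc T) (λ i → sumBelow (suc i) (λ j → h j (i ∸ j)))
  ≡⟨ sumBelow-suc T _ ⟩
    sumBelow T (λ i → sumBelow (suc i) (λ j → h j (i ∸ j))) + sumBelow (suc T) (λ j → h j (T ∸ j))
  ≡⟨ cong (_+ sumBelow (suc T) (λ j → h j (T ∸ j))) (trans (sumBelow-antidiagonal T h) (sym lastEmpty)) ⟩
    sumBelow (suc T) (λ j → sumBelow (T ∸ j) (h j)) + sumBelow (suc T) (λ j → h j (T ∸ j))
  ≡⟨ sym (sumBelow-+ (suc T) _ _) ⟩
    sumBelow (suc T) (λ j → sumBelow (T ∸ j) (h j) + h j (T ∸ j))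
  ≡⟨ sumBelow-cong (suc T) (λ j j≤T → trans (sym (sumBelow-suc (T ∸ j) (h j)))
                                        (cong (λ n → sumBelow n (h j)) (sym (ℕ.+-∸-assoc 1 (ℕ.≤-pred j≤T))))) ⟩
    sumBelow (suc T) (λ j → sumBelow (suc T ∸ j) (h j))
  ∎
  where
  open ≡-Reasoning
  F : ℕ → ℚ
  F j = sumBelow (T ∸ j) (h j)
  lastEmpty : sumBelow (suc T) F ≡ sumBelow T F
  lastEmpty = begin
    sumBelow (suc T) F                    ≡⟨ sumBelow-suc T F ⟩
    sumBelow T F + sumBelow (T ∸ T) (h T) ≡⟨ cong (λ n → sumBelow T F + sumBelow n (h T)) (ℕ.n∸n≡0 T) ⟩
    sumBelow T F + sumBelow 0 (h T)       ≡⟨ cong (sumBelow T F +_) (sumBelow-empty (h T)) ⟩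
    sumBelow T F + 0ℚ                     ≡⟨ ℚ.+-identityʳ _ ⟩
    sumBelow T F                          ∎

-- Natural numbers and their reciprocals in ℚ

toℚᵘ-ℕ→ℚ : ∀ n → toℚᵘ (ℕ→ℚ n) ≃ᵘ mkℚᵘ (ℤ.+ n) 0
toℚᵘ-ℕ→ℚ n = ℚ.toℚᵘ-fromℚᵘ (mkℚᵘ (ℤ.+ n) 0)

ℕ→ℚ-+ : ∀ a b → ℕ→ℚ (a ℕ.+ b) ≡ ℕ→ℚ a + ℕ→ℚ b
ℕ→ℚ-+ a b = ℚ.toℚᵘ-injective (ℚᵘ.≃-trans (toℚᵘ-ℕ→ℚ (a ℕ.+ b)) (ℚᵘ.≃-trans (*≡* eq)
  (ℚᵘ.≃-sym (ℚᵘ.≃-trans (ℚ.toℚᵘ-homo-+ (ℕ→ℚ a) (ℕ→ℚ b)) (ℚᵘ.+-cong (toℚᵘ-ℕ→ℚ a) (toℚᵘ-ℕ→ℚ b))))))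
  where
  eq : ℤ.+ (a ℕ.+ b) ℤ.* ℤ.+ 1 ≡ (ℤ.+ a ℤ.* ℤ.+ 1 ℤ.+ ℤ.+ b ℤ.* ℤ.+ 1) ℤ.* ℤ.+ 1
  eq = cong (ℤ._* ℤ.+ 1) (trans (ℤ.pos-+ a b) (sym (cong₂ ℤ._+_ (ℤ.*-identityʳ (ℤ.+ a)) (ℤ.*-identityʳ (ℤ.+ b)))))

ℕ→ℚ-* : ∀ a b → ℕ→ℚ (a ℕ.* b) ≡ ℕ→ℚ a * ℕ→ℚ b
ℕ→ℚ-* a b = ℚ.toℚᵘ-injective (ℚᵘ.≃-trans (toℚᵘ-ℕ→ℚ (a ℕ.* b)) (ℚᵘ.≃-trans (*≡* eq)
  (ℚᵘ.≃-sym (ℚᵘ.≃-trans (ℚ.toℚᵘ-homo-* (ℕ→ℚ a) (ℕ→ℚ b)) (ℚᵘ.*-cong (toℚᵘ-ℕ→ℚ a) (toℚᵘ-ℕ→ℚ b))))))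
  where
  eq : ℤ.+ (a ℕ.* b) ℤ.* ℤ.+ 1 ≡ (ℤ.+ a ℤ.* ℤ.+ b) ℤ.* ℤ.+ 1
  eq = cong (ℤ._* ℤ.+ 1) (ℤ.pos-* a b)

ℕ→ℚ-*-1/ : ∀ d .{{_ : ℕ.NonZero d}} → ℕ→ℚ d * ((ℤ.+ 1) / d) ≡ 1ℚ
ℕ→ℚ-*-1/ (suc d) = ℚ.toℚᵘ-injective (ℚᵘ.≃-trans (ℚ.toℚᵘ-homo-* (ℕ→ℚ (suc d)) ((ℤ.+ 1) / suc d))
  (ℚᵘ.≃-trans (ℚᵘ.*-cong (toℚᵘ-ℕ→ℚ (suc d)) (ℚ.toℚᵘ-fromℚᵘ (mkℚᵘ (ℤ.+ 1) d)))
  (ℚᵘ.≃-trans (*≡* eq) (ℚᵘ.≃-sym (toℚᵘ-ℕ→ℚ 1)))))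
  where
  eq : (ℤ.+ suc d ℤ.* ℤ.+ 1) ℤ.* ℤ.+ 1 ≡ ℤ.+ 1 ℤ.* (ℤ.+ 1 ℤ.* ℤ.+ suc d)
  eq = trans (ℤ.*-identityʳ (ℤ.+ suc d ℤ.* ℤ.+ 1))
    (trans (ℤ.*-identityʳ (ℤ.+ suc d)) (sym (trans (ℤ.*-identityˡ (ℤ.+ 1 ℤ.* ℤ.+ suc d)) (ℤ.*-identityˡ (ℤ.+ suc d)))))

infix 8 _^⁻_ _⁻¹

-- 1/m^k, with the junk value 0 ^⁻ k = 1
_^⁻_ : ℕ → ℕ → ℚ
m ^⁻ k = invPow (ℕ.pred m) k

_⁻¹ : ℕ → ℚ
m ⁻¹ = m ^⁻ 1

ℕ→ℚ-^-*-^⁻ : ∀ m k → 1 ≤ m → ℕ→ℚ (m ^ k) * m ^⁻ k ≡ 1ℚ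
ℕ→ℚ-^-*-^⁻ (suc m) k _ = ℕ→ℚ-*-1/ (suc m ^ k) {{ℕ.m^n≢0 (suc m) k}}

ℕ→ℚ-*-⁻¹ : ∀ m → 1 ≤ m → ℕ→ℚ m * m ⁻¹ ≡ 1ℚ
ℕ→ℚ-*-⁻¹ m 1≤m = trans (cong (λ n → ℕ→ℚ n * m ⁻¹) (sym (ℕ.*-identityʳ m))) (ℕ→ℚ-^-*-^⁻ m 1 1≤m)

inverse-unique : ∀ x {y z} → x * y ≡ 1ℚ → x * z ≡ 1ℚ → y ≡ z
inverse-unique x {y} {z} xy≡1 xz≡1 = begin
  y             ≡⟨ sym (ℚ.*-identityʳ y) ⟩
  y * 1ℚ        ≡⟨ cong (y *_) (sym xz≡1) ⟩
  y * (x * z)   ≡⟨ solve 3 (λ x y z → y :* (x :* z) := (x :* y) :* z) refl x y z ⟩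
  (x * y) * z   ≡⟨ cong (_* z) xy≡1 ⟩
  1ℚ * z        ≡⟨ ℚ.*-identityˡ z ⟩
  z             ∎
  where open ≡-Reasoning

^⁻-+ : ∀ m a b → m ^⁻ (a ℕ.+ b) ≡ m ^⁻ a * m ^⁻ b
^⁻-+ m a b = inverse-unique (ℕ→ℚ (m′ ^ (a ℕ.+ b))) (ℕ→ℚ-^-*-^⁻ m′ (a ℕ.+ b) (s≤s z≤n)) (begin
  ℕ→ℚ (m′ ^ (a ℕ.+ b)) * (m ^⁻ a * m ^⁻ b)             ≡⟨ cong (λ n → ℕ→ℚ n * (m ^⁻ a * m ^⁻ b)) (ℕ.^-distribˡ-+-* m′ a b) ⟩
  ℕ→ℚ (m′ ^ a ℕ.* m′ ^ b) * (m ^⁻ a * m ^⁻ b)          ≡⟨ cong (_* (m ^⁻ a * m ^⁻ b)) (ℕ→ℚ-* (m′ ^ a) (m′ ^ b)) ⟩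
  (ℕ→ℚ (m′ ^ a) * ℕ→ℚ (m′ ^ b)) * (m ^⁻ a * m ^⁻ b)    ≡⟨ solve 4 (λ x y u v → (x :* y) :* (u :* v) := (x :* u) :* (y :* v))
                                                            refl (ℕ→ℚ (m′ ^ a)) (ℕ→ℚ (m′ ^ b)) (m ^⁻ a) (m ^⁻ b) ⟩
  (ℕ→ℚ (m′ ^ a) * m ^⁻ a) * (ℕ→ℚ (m′ ^ b) * m ^⁻ b)    ≡⟨ cong₂ _*_ (ℕ→ℚ-^-*-^⁻ m′ a (s≤s z≤n)) (ℕ→ℚ-^-*-^⁻ m′ b (s≤s z≤n)) ⟩
  1ℚ                                                   ∎)
  where
  open ≡-Reasoning
  m′ : ℕ
  m′ = suc (ℕ.pred m)

cross-multiply : ∀ x x⁻ y y⁻ a b → x * x⁻ ≡ 1ℚ → y * y⁻ ≡ 1ℚ → x * a ≡ y * b → a * y⁻ ≡ b * x⁻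
cross-multiply x x⁻ y y⁻ a b xx⁻≡1 yy⁻≡1 xa≡yb = begin
  a * y⁻              ≡⟨ sym (ℚ.*-identityˡ _) ⟩
  1ℚ * (a * y⁻)       ≡⟨ cong (_* (a * y⁻)) (sym xx⁻≡1) ⟩
  (x * x⁻) * (a * y⁻) ≡⟨ solve 4 (λ x x⁻ a y⁻ → (x :* x⁻) :* (a :* y⁻) := (x :* a) :* (x⁻ :* y⁻)) refl x x⁻ a y⁻ ⟩
  (x * a) * (x⁻ * y⁻) ≡⟨ cong (_* (x⁻ * y⁻)) xa≡yb ⟩
  (y * b) * (x⁻ * y⁻) ≡⟨ solve 4 (λ y b x⁻ y⁻ → (y :* b) :* (x⁻ :* y⁻) := (y :* y⁻) :* (b :* x⁻)) refl y b x⁻ y⁻ ⟩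
  (y * y⁻) * (b * x⁻) ≡⟨ cong (_* (b * x⁻)) yy⁻≡1 ⟩
  1ℚ * (b * x⁻)       ≡⟨ ℚ.*-identityˡ _ ⟩
  b * x⁻              ∎
  where open ≡-Reasoning

-- Binomial coefficients

infix 8 _C_

-- Defined by Pascal's rule (rather than taken from Data.Nat.Combinatorics) so that its identities go by induction.
_C_ : ℕ → ℕ → ℕ
n     C zero  = 1
zero  C suc k = 0
suc n C suc k = n C k ℕ.+ n C suc k

k>n⇒nCk≡0 : ∀ {n k} → n < k → n C k ≡ 0
k>n⇒nCk≡0 {zero}  {suc k} _         = refl
k>n⇒nCk≡0 {suc n} {suc k} (s≤s n<k) = cong₂ ℕ._+_ (k>n⇒nCk≡0 n<k) (k>n⇒nCk≡0 (ℕ.m<n⇒m<1+n n<k))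

k≤n⇒nCk>0 : ∀ {n k} → k ≤ n → 0 < n C k
k≤n⇒nCk>0 {n}     {zero}  _         = s≤s z≤n
k≤n⇒nCk>0 {suc n} {suc k} (s≤s k≤n) = ℕ.≤-trans (k≤n⇒nCk>0 k≤n) (ℕ.m≤m+n (n C k) _)

nC1≡n : ∀ n → n C 1 ≡ n
nC1≡n zero    = refl
nC1≡n (suc n) = cong suc (nC1≡n n)

[1+k]*nC[1+k]+k*nCk≡n*nCk : ∀ n k → suc k ℕ.* n C suc k ℕ.+ k ℕ.* n C k ≡ n ℕ.* n C k
[1+k]*nC[1+k]+k*nCk≡n*nCk zero    zero    = refl
[1+k]*nC[1+k]+k*nCk≡n*nCk zero    (suc k) = cong₂ ℕ._+_ (ℕ.*-zeroʳ (suc (suc k))) (ℕ.*-zeroʳ (suc k))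
[1+k]*nC[1+k]+k*nCk≡n*nCk (suc n) zero    = trans (cong (λ x → 1 ℕ.* suc x ℕ.+ 0) (nC1≡n n)) (regroup n)
  where
  regroup : ∀ n → 1 ℕ.* suc n ℕ.+ 0 ≡ suc n ℕ.* 1
  regroup = solve-∀
[1+k]*nC[1+k]+k*nCk≡n*nCk (suc n) (suc k) = begin
    (2 ℕ.+ k) ℕ.* (B ℕ.+ C′) ℕ.+ (1 ℕ.+ k) ℕ.* (A ℕ.+ B)
  ≡⟨ regroup₁ k A B C′ ⟩
    ((2 ℕ.+ k) ℕ.* C′ ℕ.+ (1 ℕ.+ k) ℕ.* B) ℕ.+ (2 ℕ.+ k) ℕ.* B ℕ.+ (1 ℕ.+ k) ℕ.* A
  ≡⟨ cong (λ x → x ℕ.+ (2 ℕ.+ k) ℕ.* B ℕ.+ (1 ℕ.+ k) ℕ.* A) ([1+k]*nC[1+k]+k*nCk≡n*nCk n (suc k)) ⟩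
    n ℕ.* B ℕ.+ (2 ℕ.+ k) ℕ.* B ℕ.+ (1 ℕ.+ k) ℕ.* A
  ≡⟨ regroup₂ k A B n ⟩
    n ℕ.* B ℕ.+ B ℕ.+ A ℕ.+ ((1 ℕ.+ k) ℕ.* B ℕ.+ k ℕ.* A)
  ≡⟨ cong (λ x → n ℕ.* B ℕ.+ B ℕ.+ A ℕ.+ x) ([1+k]*nC[1+k]+k*nCk≡n*nCk n k) ⟩
    n ℕ.* B ℕ.+ B ℕ.+ A ℕ.+ n ℕ.* A
  ≡⟨ regroup₃ n A B ⟩
    (1 ℕ.+ n) ℕ.* (A ℕ.+ B)
  ∎
  where
  open ≡-Reasoning
  A B C′ : ℕ
  A  = n C k
  B  = n C suc k
  C′ = n C suc (suc k)
  regroup₁ : ∀ k A B C′ → (2 ℕ.+ k) ℕ.* (B ℕ.+ C′) ℕ.+ (1 ℕ.+ k) ℕ.* (A ℕ.+ B)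
                        ≡ ((2 ℕ.+ k) ℕ.* C′ ℕ.+ (1 ℕ.+ k) ℕ.* B) ℕ.+ (2 ℕ.+ k) ℕ.* B ℕ.+ (1 ℕ.+ k) ℕ.* A
  regroup₁ = solve-∀
  regroup₂ : ∀ k A B n → n ℕ.* B ℕ.+ (2 ℕ.+ k) ℕ.* B ℕ.+ (1 ℕ.+ k) ℕ.* A
                       ≡ n ℕ.* B ℕ.+ B ℕ.+ A ℕ.+ ((1 ℕ.+ k) ℕ.* B ℕ.+ k ℕ.* A)
  regroup₂ = solve-∀
  regroup₃ : ∀ n A B → n ℕ.* B ℕ.+ B ℕ.+ A ℕ.+ n ℕ.* A ≡ (1 ℕ.+ n) ℕ.* (A ℕ.+ B)
  regroup₃ = solve-∀

[1+k]*[1+n]C[1+k]≡[1+n]*nCk : ∀ n k → suc k ℕ.* suc n C suc k ≡ suc n ℕ.* n C k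
[1+k]*[1+n]C[1+k]≡[1+n]*nCk n k = begin
  suc k ℕ.* (n C k ℕ.+ n C suc k)                            ≡⟨ regroup k (n C k) (n C suc k) ⟩
  n C k ℕ.+ (suc k ℕ.* n C suc k ℕ.+ k ℕ.* n C k)             ≡⟨ cong (n C k ℕ.+_) ([1+k]*nC[1+k]+k*nCk≡n*nCk n k) ⟩
  n C k ℕ.+ n ℕ.* n C k                                      ∎
  where
  open ≡-Reasoning
  regroup : ∀ k A B → suc k ℕ.* (A ℕ.+ B) ≡ A ℕ.+ (suc k ℕ.* B ℕ.+ k ℕ.* A)
  regroup = solve-∀

d₁*nCk+[1+k]*nC[1+k]≡d₂*nCk : ∀ {n k} d₁ d₂ → d₁ ℕ.+ n ≡ d₂ ℕ.+ k →
  d₁ ℕ.* n C k ℕ.+ suc k ℕ.* n C suc k ≡ d₂ ℕ.* n C k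
d₁*nCk+[1+k]*nC[1+k]≡d₂*nCk {n} {k} d₁ d₂ d₁+n≡d₂+k = ℕ.+-cancelʳ-≡ (k ℕ.* A) _ _ (begin
  (d₁ ℕ.* A ℕ.+ suc k ℕ.* B) ℕ.+ k ℕ.* A  ≡⟨ ℕ.+-assoc (d₁ ℕ.* A) _ _ ⟩
  d₁ ℕ.* A ℕ.+ (suc k ℕ.* B ℕ.+ k ℕ.* A)  ≡⟨ cong (d₁ ℕ.* A ℕ.+_) ([1+k]*nC[1+k]+k*nCk≡n*nCk n k) ⟩
  d₁ ℕ.* A ℕ.+ n ℕ.* A                    ≡⟨ sym (ℕ.*-distribʳ-+ A d₁ n) ⟩
  (d₁ ℕ.+ n) ℕ.* A                        ≡⟨ cong (ℕ._* A) d₁+n≡d₂+k ⟩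
  (d₂ ℕ.+ k) ℕ.* A                        ≡⟨ ℕ.*-distribʳ-+ A d₂ k ⟩
  d₂ ℕ.* A ℕ.+ k ℕ.* A                    ∎)
  where
  open ≡-Reasoning
  A B : ℕ
  A = n C k
  B = n C suc k

[n∸m]+pred[m]≡pred[n] : ∀ {m n} → 1 ≤ m → m ≤ n → (n ∸ m) ℕ.+ ℕ.pred m ≡ ℕ.pred n
[n∸m]+pred[m]≡pred[n] {suc m} {suc n} _ (s≤s m≤n) = ℕ.m∸n+n≡m m≤n

nCk⁻¹≡[n∸k]*[1+k]⁻¹*nC[1+k]⁻¹ : ∀ n k → suc k ≤ n → (n C k) ⁻¹ ≡ ℕ→ℚ (n ∸ k) * (suc k) ⁻¹ * (n C suc k) ⁻¹
nCk⁻¹≡[n∸k]*[1+k]⁻¹*nC[1+k]⁻¹ n k 1+k≤n = begin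
  u                       ≡⟨ sym (ℚ.*-identityʳ u) ⟩
  u * 1ℚ                  ≡⟨ cong (u *_) (sym (ℕ→ℚ-*-⁻¹ (n C suc k) (k≤n⇒nCk>0 1+k≤n))) ⟩
  u * (ℕ→ℚ (n C suc k) * v) ≡⟨ solve 3 (λ u c v → u :* (c :* v) := (c :* u) :* v) refl u (ℕ→ℚ (n C suc k)) v ⟩
  (ℕ→ℚ (n C suc k) * u) * v ≡⟨ cong (_* v) (sym (cross-multiply (ℕ→ℚ (n C k)) u (ℕ→ℚ (suc k)) w d (ℕ→ℚ (n C suc k))
                                (ℕ→ℚ-*-⁻¹ (n C k) (k≤n⇒nCk>0 (ℕ.<⇒≤ 1+k≤n))) (ℕ→ℚ-*-⁻¹ (suc k) (s≤s z≤n)) nCk*d≡[1+k]*nC[1+k])) ⟩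
  d * w * v               ∎
  where
  open ≡-Reasoning
  u v w d : ℚ
  u = (n C k) ⁻¹
  v = (n C suc k) ⁻¹
  w = (suc k) ⁻¹
  d = ℕ→ℚ (n ∸ k)
  nCk*d≡[1+k]*nC[1+k] : ℕ→ℚ (n C k) * d ≡ ℕ→ℚ (suc k) * ℕ→ℚ (n C suc k)
  nCk*d≡[1+k]*nC[1+k] = begin
    ℕ→ℚ (n C k) * d              ≡⟨ sym (ℕ→ℚ-* (n C k) (n ∸ k)) ⟩
    ℕ→ℚ (n C k ℕ.* (n ∸ k))      ≡⟨ cong ℕ→ℚ (trans (ℕ.*-comm (n C k) (n ∸ k))
                                     (sym (d₁*nCk+[1+k]*nC[1+k]≡d₂*nCk 0 (n ∸ k) (sym (ℕ.m∸n+n≡m (ℕ.<⇒≤ 1+k≤n)))))) ⟩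
    ℕ→ℚ (suc k ℕ.* n C suc k)    ≡⟨ ℕ→ℚ-* (suc k) (n C suc k) ⟩
    ℕ→ℚ (suc k) * ℕ→ℚ (n C suc k) ∎

-- Harmonic tails and the reflected sum

module _ (N : ℕ) where

  harmonicTail : (ℕ → ℚ) → ℕ → ℚ
  harmonicTail h n = n ⁻¹ * h n + sumBetween n N (λ m → m ⁻¹ * h m)

  harmonicTail^ : ℕ → (ℕ → ℚ) → ℕ → ℚ
  harmonicTail^ zero    h = h
  harmonicTail^ (suc e) h = harmonicTail (harmonicTail^ e h)

  reflectedSum : Index → ℕ → ℚ
  reflectedSum []       a = 1ℚ
  reflectedSum (k ∷ ks) a = sumBetween a N (λ n → (N ∸ n) ⁻¹ * harmonicTail^ (ℕ.pred k) (reflectedSum ks) n)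

record IsLinear (L : (ℕ → ℚ) → ℕ → ℚ) : Set where
  field
    cong-≗ : ∀ {f g} → (∀ x → f x ≡ g x) → ∀ n → L f n ≡ L g n
    +-homo : ∀ f g n → L (λ x → f x + g x) n ≡ L f n + L g n
    *-homo : ∀ c f n → L (λ x → c * f x) n ≡ c * L f n

  0-homo : ∀ n → L (λ _ → 0ℚ) n ≡ 0ℚ
  0-homo n = trans (*-homo 0ℚ (λ _ → 0ℚ) n) (ℚ.*-zeroˡ (L (λ _ → 0ℚ) n))

  *ʳ-homo : ∀ c f n → L (λ x → f x * c) n ≡ L f n * c
  *ʳ-homo c f n = trans (cong-≗ (λ x → ℚ.*-comm (f x) c) n) (trans (*-homo c f n) (ℚ.*-comm c (L f n)))

  sumBelow-homo : ∀ T (f : ℕ → ℕ → ℚ) n → L (λ x → sumBelow T (λ i → f i x)) n ≡ sumBelow T (λ i → L (f i) n)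
  sumBelow-homo zero    f n = trans (cong-≗ (λ x → sumBelow-empty (λ i → f i x)) n)
                                   (trans (0-homo n) (sym (sumBelow-empty (λ i → L (f i) n))))
  sumBelow-homo (suc T) f n = begin
    L (λ x → sumBelow (suc T) (λ i → f i x)) n                ≡⟨ cong-≗ (λ x → sumBelow-suc T (λ i → f i x)) n ⟩
    L (λ x → sumBelow T (λ i → f i x) + f T x) n              ≡⟨ +-homo (λ x → sumBelow T (λ i → f i x)) (f T) n ⟩
    L (λ x → sumBelow T (λ i → f i x)) n + L (f T) n          ≡⟨ cong (_+ L (f T) n) (sumBelow-homo T f n) ⟩
    sumBelow T (λ i → L (f i) n) + L (f T) n                  ≡⟨ sym (sumBelow-suc T (λ i → L (f i) n)) ⟩
    sumBelow (suc T) (λ i → L (f i) n)                        ∎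
    where open ≡-Reasoning

  sumOver-homo : ∀ {A : Set} (xs : List A) (f : A → ℕ → ℚ) n →
    L (λ x → sumOver xs (λ l → f l x)) n ≡ sumOver xs (λ l → L (f l) n)
  sumOver-homo []       f n = 0-homo n
  sumOver-homo (y ∷ ys) f n =
    trans (+-homo (f y) (λ x → sumOver ys (λ l → f l x)) n) (cong (L (f y) n +_) (sumOver-homo ys f n))

id-linear : IsLinear (λ f → f)
id-linear = record { cong-≗ = λ f≗g → f≗g ; +-homo = λ _ _ _ → refl ; *-homo = λ _ _ _ → refl }

∘-linear : ∀ {L₁ L₂} → IsLinear L₁ → IsLinear L₂ → IsLinear (λ f → L₁ (L₂ f))
∘-linear {L₁} {L₂} L₁-linear L₂-linear = record
  { cong-≗ = λ f≗g → L₁.cong-≗ (L₂.cong-≗ f≗g)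
  ; +-homo = λ f g n → trans (L₁.cong-≗ (L₂.+-homo f g) n) (L₁.+-homo (L₂ f) (L₂ g) n)
  ; *-homo = λ c f n → trans (L₁.cong-≗ (L₂.*-homo c f) n) (L₁.*-homo c (L₂ f) n)
  }
  where
  module L₁ = IsLinear L₁-linear
  module L₂ = IsLinear L₂-linear

module _ (N : ℕ) where

  harmonicTail-linear : IsLinear (harmonicTail N)
  harmonicTail-linear = record { cong-≗ = cong-≗ ; +-homo = +-homo ; *-homo = *-homo }
    where
    cong-≗ : ∀ {f g} → (∀ x → f x ≡ g x) → ∀ n → harmonicTail N f n ≡ harmonicTail N g n
    cong-≗ f≗g n = cong₂ _+_ (cong (n ⁻¹ *_) (f≗g n)) (sumBetween-cong n N (λ m _ _ → cong (m ⁻¹ *_) (f≗g m)))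
    +-homo : ∀ f g n → harmonicTail N (λ x → f x + g x) n ≡ harmonicTail N f n + harmonicTail N g n
    +-homo f g n = begin
      n ⁻¹ * (f n + g n) + sumBetween n N (λ m → m ⁻¹ * (f m + g m))
        ≡⟨ cong₂ _+_ (ℚ.*-distribˡ-+ (n ⁻¹) (f n) (g n))
                     (trans (sumBetween-cong n N (λ m _ _ → ℚ.*-distribˡ-+ (m ⁻¹) (f m) (g m)))
                            (sumBetween-+ n N (λ m → m ⁻¹ * f m) (λ m → m ⁻¹ * g m))) ⟩
      (n ⁻¹ * f n + n ⁻¹ * g n) + (sumBetween n N (λ m → m ⁻¹ * f m) + sumBetween n N (λ m → m ⁻¹ * g m))
        ≡⟨ solve 4 (λ a b c d → (a :+ b) :+ (c :+ d) := (a :+ c) :+ (b :+ d)) refl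
             (n ⁻¹ * f n) (n ⁻¹ * g n) (sumBetween n N (λ m → m ⁻¹ * f m)) (sumBetween n N (λ m → m ⁻¹ * g m)) ⟩
      harmonicTail N f n + harmonicTail N g n
        ∎
      where open ≡-Reasoning
    *-homo : ∀ c f n → harmonicTail N (λ x → c * f x) n ≡ c * harmonicTail N f n
    *-homo c f n = begin
      n ⁻¹ * (c * f n) + sumBetween n N (λ m → m ⁻¹ * (c * f m))
        ≡⟨ cong₂ _+_ (x∙yz≈y∙xz (n ⁻¹) c (f n)) (trans (sumBetween-cong n N (λ m _ _ → x∙yz≈y∙xz (m ⁻¹) c (f m)))
                                                  (sumBetween-*ˡ n N c (λ m → m ⁻¹ * f m))) ⟩
      c * (n ⁻¹ * f n) + c * sumBetween n N (λ m → m ⁻¹ * f m)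
        ≡⟨ sym (ℚ.*-distribˡ-+ c (n ⁻¹ * f n) (sumBetween n N (λ m → m ⁻¹ * f m))) ⟩
      c * harmonicTail N f n
        ∎
      where open ≡-Reasoning

  harmonicTail^-linear : ∀ e → IsLinear (harmonicTail^ N e)
  harmonicTail^-linear zero    = id-linear
  harmonicTail^-linear (suc e) = ∘-linear harmonicTail-linear (harmonicTail^-linear e)

H-∷ : ∀ a N k ks → H a N (k ∷ ks) ≡ sumBetween a N (λ m → m ^⁻ k * H m N ks)
H-∷ a N k ks = trans (sumOver-upTo (N ∸ suc a) _) (sym (sumBetween-as-sumBelow a N (λ m → m ^⁻ k * H m N ks)))

-- The connector

module Connector (N : ℕ) where

  κ : ℕ → ℕ → ℚ
  κ i j = ℕ→ℚ (ℕ.pred j C ℕ.pred i) * (ℕ.pred N C i) ⁻¹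

  ρ : ℕ → ℕ → ℚ
  ρ i x = ℕ→ℚ (x C i) * (ℕ.pred N C i) ⁻¹

  sumBetween-κ : ∀ i x → 1 ≤ i → sumBetween 0 (suc x) (κ i) ≡ ρ i x
  sumBetween-κ (suc i) zero    _ = trans (sumBetween-empty 0 1 (κ (suc i)) ℕ.≤-refl) (sym (ℚ.*-zeroˡ ((ℕ.pred N C suc i) ⁻¹)))
  sumBetween-κ (suc i) (suc x) _ = begin
    sumBetween 0 (suc (suc x)) (κ (suc i))                  ≡⟨ sumBetween-suc 0 (suc x) (κ (suc i)) (s≤s z≤n) ⟩
    sumBetween 0 (suc x) (κ (suc i)) + κ (suc i) (suc x)    ≡⟨ cong (_+ κ (suc i) (suc x)) (sumBetween-κ (suc i) x (s≤s z≤n)) ⟩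
    ℕ→ℚ (x C suc i) * c + ℕ→ℚ (x C i) * c                  ≡⟨ sym (ℚ.*-distribʳ-+ c (ℕ→ℚ (x C suc i)) (ℕ→ℚ (x C i))) ⟩
    (ℕ→ℚ (x C suc i) + ℕ→ℚ (x C i)) * c                    ≡⟨ cong (_* c) (trans (ℚ.+-comm (ℕ→ℚ (x C suc i)) (ℕ→ℚ (x C i))) (sym (ℕ→ℚ-+ (x C i) (x C suc i)))) ⟩
    ℕ→ℚ (suc x C suc i) * c                                 ∎
    where
    open ≡-Reasoning
    c : ℚ
    c = (ℕ.pred N C suc i) ⁻¹

  ρ-top : ∀ i → i < N → ρ i (ℕ.pred N) ≡ 1ℚ
  ρ-top i i<N = ℕ→ℚ-*-⁻¹ (ℕ.pred N C i) (k≤n⇒nCk>0 (ℕ.<⇒≤pred i<N))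

  ⁻¹-*-κ : ∀ m j → 1 ≤ m → 1 ≤ j → m ⁻¹ * κ m j ≡ ρ m j * j ⁻¹
  ⁻¹-*-κ m@(suc m′) j@(suc j′) 1≤m 1≤j = begin
    m ⁻¹ * (A * c)  ≡⟨ solve 3 (λ u A c → u :* (A :* c) := (A :* u) :* c) refl (m ⁻¹) A c ⟩
    (A * m ⁻¹) * c  ≡⟨ cong (_* c) (cross-multiply (ℕ→ℚ j) (j ⁻¹) (ℕ→ℚ m) (m ⁻¹) A B (ℕ→ℚ-*-⁻¹ j 1≤j) (ℕ→ℚ-*-⁻¹ m 1≤m) jA≡mB) ⟩
    (B * j ⁻¹) * c  ≡⟨ solve 3 (λ B v c → (B :* v) :* c := (B :* c) :* v) refl B (j ⁻¹) c ⟩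
    (B * c) * j ⁻¹  ∎
    where
    open ≡-Reasoning
    A B c : ℚ
    A = ℕ→ℚ (j′ C m′)
    B = ℕ→ℚ (j C m)
    c = (ℕ.pred N C m) ⁻¹
    jA≡mB : ℕ→ℚ j * A ≡ ℕ→ℚ m * B
    jA≡mB = trans (sym (ℕ→ℚ-* j (j′ C m′)))
              (trans (cong ℕ→ℚ (sym ([1+k]*[1+n]C[1+k]≡[1+n]*nCk j′ m′))) (ℕ→ℚ-* m (j C m)))

  ⁻¹-*-sumBetween-κ : ∀ (g : ℕ → ℚ) m → 1 ≤ m →
    m ⁻¹ * sumBetween 0 N (λ j → κ m j * g j) ≡ sumBetween 0 N (λ j → κ m j * harmonicTail N g j)
  ⁻¹-*-sumBetween-κ g m 1≤m = begin
      m ⁻¹ * sumBetween 0 N (λ j → κ m j * g j)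
    ≡⟨ sym (sumBetween-*ˡ 0 N (m ⁻¹) (λ j → κ m j * g j)) ⟩
      sumBetween 0 N (λ j → m ⁻¹ * (κ m j * g j))
    ≡⟨ sumBetween-cong 0 N (λ j 0<j _ → pointwise j 0<j) ⟩
      sumBetween 0 N (λ j → sumBetween 0 j (κ m) * h j + κ m j * h j)
    ≡⟨ sumBetween-+ 0 N (λ j → sumBetween 0 j (κ m) * h j) (λ j → κ m j * h j) ⟩
      sumBetween 0 N (λ j → sumBetween 0 j (κ m) * h j) + sumBetween 0 N (λ j → κ m j * h j)
    ≡⟨ cong (_+ sumBetween 0 N (λ j → κ m j * h j)) (sym (sumBetween-triangle N (κ m) h)) ⟩
      sumBetween 0 N (λ j → κ m j * sumBetween j N h) + sumBetween 0 N (λ j → κ m j * h j)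
    ≡⟨ trans (ℚ.+-comm (sumBetween 0 N (λ j → κ m j * sumBetween j N h)) (sumBetween 0 N (λ j → κ m j * h j)))
         (sym (sumBetween-+ 0 N (λ j → κ m j * h j) (λ j → κ m j * sumBetween j N h))) ⟩
      sumBetween 0 N (λ j → κ m j * h j + κ m j * sumBetween j N h)
    ≡⟨ sumBetween-cong 0 N (λ j _ _ → sym (ℚ.*-distribˡ-+ (κ m j) (h j) (sumBetween j N h))) ⟩
      sumBetween 0 N (λ j → κ m j * harmonicTail N g j)
    ∎
    where
    open ≡-Reasoning
    h : ℕ → ℚ
    h j = j ⁻¹ * g j
    pointwise : ∀ j → 0 < j → m ⁻¹ * (κ m j * g j) ≡ sumBetween 0 j (κ m) * h j + κ m j * h j
    pointwise j 0<j = begin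
      m ⁻¹ * (κ m j * g j)                       ≡⟨ sym (ℚ.*-assoc (m ⁻¹) (κ m j) (g j)) ⟩
      (m ⁻¹ * κ m j) * g j                       ≡⟨ cong (_* g j) (⁻¹-*-κ m j 1≤m 0<j) ⟩
      (ρ m j * j ⁻¹) * g j                       ≡⟨ ℚ.*-assoc (ρ m j) (j ⁻¹) (g j) ⟩
      ρ m j * h j                                ≡⟨ cong (_* h j) (sym (sumBetween-κ m j 1≤m)) ⟩
      sumBetween 0 (suc j) (κ m) * h j           ≡⟨ cong (_* h j) (sumBetween-suc 0 j (κ m) 0<j) ⟩
      (sumBetween 0 j (κ m) + κ m j) * h j       ≡⟨ ℚ.*-distribʳ-+ (h j) (sumBetween 0 j (κ m)) (κ m j) ⟩
      sumBetween 0 j (κ m) * h j + κ m j * h j   ∎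

  ^⁻-*-sumBetween-κ : ∀ e (g : ℕ → ℚ) m → 1 ≤ m →
    m ^⁻ e * sumBetween 0 N (λ j → κ m j * g j) ≡ sumBetween 0 N (λ j → κ m j * harmonicTail^ N e g j)
  ^⁻-*-sumBetween-κ zero    g m _   = ℚ.*-identityˡ _
  ^⁻-*-sumBetween-κ (suc e) g m 1≤m = begin
    m ^⁻ suc e * S g                          ≡⟨ cong (_* S g) (^⁻-+ m 1 e) ⟩
    (m ⁻¹ * m ^⁻ e) * S g                     ≡⟨ ℚ.*-assoc (m ⁻¹) (m ^⁻ e) (S g) ⟩
    m ⁻¹ * (m ^⁻ e * S g)                     ≡⟨ cong (m ⁻¹ *_) (^⁻-*-sumBetween-κ e g m 1≤m) ⟩
    m ⁻¹ * S (harmonicTail^ N e g)            ≡⟨ ⁻¹-*-sumBetween-κ (harmonicTail^ N e g) m 1≤m ⟩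
    S (harmonicTail^ N (suc e) g)             ∎
    where
    open ≡-Reasoning
    S : (ℕ → ℚ) → ℚ
    S f = sumBetween 0 N (λ j → κ m j * f j)

  ρ-recurrence : ∀ i j → suc i < N → 1 ≤ j → j < N →
    (suc i) ⁻¹ * κ (suc i) j + ρ (suc i) (ℕ.pred j) * (N ∸ j) ⁻¹ ≡ ρ i (ℕ.pred j) * (N ∸ j) ⁻¹
  ρ-recurrence i j 1+i<N 1≤j j<N = sym (begin
      (A * u) * z                              ≡⟨ cong (λ t → (A * t) * z) (nCk⁻¹≡[n∸k]*[1+k]⁻¹*nC[1+k]⁻¹ (ℕ.pred N) i 1+i≤pred[N]) ⟩
      (A * (d * w * v)) * z                    ≡⟨ solve 5 (λ A d w v z → (A :* (d :* w :* v)) :* z := (w :* v :* z) :* (d :* A)) refl A d w v z ⟩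
      (w * v * z) * (d * A)                    ≡⟨ cong ((w * v * z) *_) dA≡[N∸j]A+[1+i]B ⟩
      (w * v * z) * (ℕ→ℚ (N ∸ j) * A + ℕ→ℚ (suc i) * B)
        ≡⟨ solve 7 (λ w v z n A s B → (w :* v :* z) :* (n :* A :+ s :* B) := w :* (A :* v) :* (n :* z) :+ (B :* v) :* z :* (s :* w))
             refl w v z (ℕ→ℚ (N ∸ j)) A (ℕ→ℚ (suc i)) B ⟩
      w * (A * v) * (ℕ→ℚ (N ∸ j) * z) + (B * v) * z * (ℕ→ℚ (suc i) * w)
        ≡⟨ cong₂ (λ s t → w * (A * v) * s + (B * v) * z * t) (ℕ→ℚ-*-⁻¹ (N ∸ j) (ℕ.m<n⇒0<n∸m j<N)) (ℕ→ℚ-*-⁻¹ (suc i) (s≤s z≤n)) ⟩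
      w * (A * v) * 1ℚ + (B * v) * z * 1ℚ     ≡⟨ cong₂ _+_ (ℚ.*-identityʳ (w * (A * v))) (ℚ.*-identityʳ ((B * v) * z)) ⟩
      w * (A * v) + (B * v) * z                ∎)
    where
    open ≡-Reasoning
    A B u v w z d : ℚ
    A = ℕ→ℚ (ℕ.pred j C i)
    B = ℕ→ℚ (ℕ.pred j C suc i)
    u = (ℕ.pred N C i) ⁻¹
    v = (ℕ.pred N C suc i) ⁻¹
    w = (suc i) ⁻¹
    z = (N ∸ j) ⁻¹
    d = ℕ→ℚ (ℕ.pred N ∸ i)
    1+i≤pred[N] : suc i ≤ ℕ.pred N
    1+i≤pred[N] = ℕ.<⇒≤pred 1+i<N
    [N∸j]+pred[j]≡[pred[N]∸i]+i : (N ∸ j) ℕ.+ ℕ.pred j ≡ (ℕ.pred N ∸ i) ℕ.+ i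
    [N∸j]+pred[j]≡[pred[N]∸i]+i = trans ([n∸m]+pred[m]≡pred[n] 1≤j (ℕ.<⇒≤ j<N)) (sym (ℕ.m∸n+n≡m (ℕ.<⇒≤ 1+i≤pred[N])))
    dA≡[N∸j]A+[1+i]B : d * A ≡ ℕ→ℚ (N ∸ j) * A + ℕ→ℚ (suc i) * B
    dA≡[N∸j]A+[1+i]B = begin
      d * A                                                        ≡⟨ sym (ℕ→ℚ-* (ℕ.pred N ∸ i) (ℕ.pred j C i)) ⟩
      ℕ→ℚ ((ℕ.pred N ∸ i) ℕ.* ℕ.pred j C i)                       ≡⟨ cong ℕ→ℚ (sym (d₁*nCk+[1+k]*nC[1+k]≡d₂*nCk (N ∸ j) (ℕ.pred N ∸ i)
                                                                        [N∸j]+pred[j]≡[pred[N]∸i]+i)) ⟩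
      ℕ→ℚ ((N ∸ j) ℕ.* ℕ.pred j C i ℕ.+ suc i ℕ.* ℕ.pred j C suc i) ≡⟨ ℕ→ℚ-+ ((N ∸ j) ℕ.* ℕ.pred j C i) (suc i ℕ.* ℕ.pred j C suc i) ⟩
      ℕ→ℚ ((N ∸ j) ℕ.* ℕ.pred j C i) + ℕ→ℚ (suc i ℕ.* ℕ.pred j C suc i)
                                                                   ≡⟨ cong₂ _+_ (ℕ→ℚ-* (N ∸ j) (ℕ.pred j C i)) (ℕ→ℚ-* (suc i) (ℕ.pred j C suc i)) ⟩
      ℕ→ℚ (N ∸ j) * A + ℕ→ℚ (suc i) * B                           ∎

  sumBetween-⁻¹-*-κ : ∀ i → i < N → ∀ j → 1 ≤ j → j < N →
    sumBetween i N (λ m → m ⁻¹ * κ m j) ≡ ρ i (ℕ.pred j) * (N ∸ j) ⁻¹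
  sumBetween-⁻¹-*-κ i i<N = go (ℕ.pred N ∸ i) i (ℕ.m∸n+n≡m (ℕ.<⇒≤pred i<N))
    where
    instance
      N≢0 : ℕ.NonZero N
      N≢0 = ℕ.>-nonZero (ℕ.<-≤-trans (s≤s z≤n) i<N)
    go : ∀ t i → t ℕ.+ i ≡ ℕ.pred N → ∀ j → 1 ≤ j → j < N →
      sumBetween i N (λ m → m ⁻¹ * κ m j) ≡ ρ i (ℕ.pred j) * (N ∸ j) ⁻¹
    go zero    i i≡pred[N] j 1≤j j<N = begin
      sumBetween i N (λ m → m ⁻¹ * κ m j)  ≡⟨ sumBetween-empty i N (λ m → m ⁻¹ * κ m j) N≤1+i ⟩
      0ℚ                                   ≡⟨ sym (ℚ.*-zeroˡ ((N ∸ j) ⁻¹)) ⟩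
      0ℚ * (N ∸ j) ⁻¹                      ≡⟨ cong (_* (N ∸ j) ⁻¹) (sym ρ≡0) ⟩
      ρ i (ℕ.pred j) * (N ∸ j) ⁻¹          ∎
      where
      open ≡-Reasoning
      N≤1+i : N ≤ suc i
      N≤1+i = ℕ.≤-trans (ℕ.≤-reflexive (sym (ℕ.suc-pred N))) (s≤s (ℕ.≤-reflexive (sym i≡pred[N])))
      pred[j]<i : ℕ.pred j < i
      pred[j]<i = ℕ.<-≤-trans (ℕ.pred-mono-< {{ℕ.>-nonZero 1≤j}} j<N) (ℕ.≤-reflexive (sym i≡pred[N]))
      ρ≡0 : ρ i (ℕ.pred j) ≡ 0ℚ
      ρ≡0 = trans (cong (λ x → ℕ→ℚ x * (ℕ.pred N C i) ⁻¹) (k>n⇒nCk≡0 pred[j]<i)) (ℚ.*-zeroˡ ((ℕ.pred N C i) ⁻¹))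
    go (suc t) i t+i≡pred[N] j 1≤j j<N = begin
      sumBetween i N f                                                    ≡⟨ sumBetween-head i N f 1+i<N ⟩
      f (suc i) + sumBetween (suc i) N f                                  ≡⟨ cong (f (suc i) +_) (go t (suc i) (trans (ℕ.+-suc t i) t+i≡pred[N]) j 1≤j j<N) ⟩
      (suc i) ⁻¹ * κ (suc i) j + ρ (suc i) (ℕ.pred j) * (N ∸ j) ⁻¹        ≡⟨ ρ-recurrence i j 1+i<N 1≤j j<N ⟩
      ρ i (ℕ.pred j) * (N ∸ j) ⁻¹                                         ∎
      where
      open ≡-Reasoning
      f : ℕ → ℚ
      f m = m ⁻¹ * κ m j
      1+i<N : suc i < N
      1+i<N = ℕ.m≤pred[n]⇒suc[m]≤n (ℕ.≤-trans (s≤s (ℕ.m≤n+m i t)) (ℕ.≤-reflexive t+i≡pred[N]))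

  ConnectorExpansion : Index → Set
  ConnectorExpansion ks = ∀ m → 1 ≤ m → m < N → H m N ks ≡ sumBetween 0 N (λ j → κ m j * reflectedSum N ks j)

  reflectedTerm : ℕ → Index → ℕ → ℚ
  reflectedTerm k ks j = (N ∸ j) ⁻¹ * harmonicTail^ N (ℕ.pred k) (reflectedSum N ks) j

  H-∷-ρ : ∀ k ks → 1 ≤ k → ConnectorExpansion ks → ∀ i → i < N →
    H i N (k ∷ ks) ≡ sumBetween 0 N (λ j → ρ i (ℕ.pred j) * reflectedTerm k ks j)
  H-∷-ρ k@(suc k′) ks _ expand i i<N = begin
      H i N (k ∷ ks)
    ≡⟨ H-∷ i N k ks ⟩
      sumBetween i N (λ m → m ^⁻ k * H m N ks)
    ≡⟨ sumBetween-cong i N (λ m i<m m<N → pointwise m (ℕ.<-≤-trans (s≤s z≤n) i<m) m<N) ⟩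
      sumBetween i N (λ m → sumBetween 0 N (λ j → (m ⁻¹ * κ m j) * t j))
    ≡⟨ sumBetween-comm i N 0 N (λ m j → (m ⁻¹ * κ m j) * t j) ⟩
      sumBetween 0 N (λ j → sumBetween i N (λ m → (m ⁻¹ * κ m j) * t j))
    ≡⟨ sumBetween-cong 0 N (λ j 0<j j<N → trans (sumBetween-*ʳ i N (t j) (λ m → m ⁻¹ * κ m j))
                                            (cong (_* t j) (sumBetween-⁻¹-*-κ i i<N j 0<j j<N))) ⟩
      sumBetween 0 N (λ j → (ρ i (ℕ.pred j) * (N ∸ j) ⁻¹) * t j)
    ≡⟨ sumBetween-cong 0 N (λ j _ _ → ℚ.*-assoc (ρ i (ℕ.pred j)) ((N ∸ j) ⁻¹) (t j)) ⟩
      sumBetween 0 N (λ j → ρ i (ℕ.pred j) * reflectedTerm k ks j)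
    ∎
    where
    open ≡-Reasoning
    t : ℕ → ℚ
    t = harmonicTail^ N k′ (reflectedSum N ks)
    S : (ℕ → ℚ) → ℕ → ℚ
    S f m = sumBetween 0 N (λ j → κ m j * f j)
    pointwise : ∀ m → 1 ≤ m → m < N → m ^⁻ k * H m N ks ≡ sumBetween 0 N (λ j → (m ⁻¹ * κ m j) * t j)
    pointwise m 1≤m m<N = begin
      m ^⁻ k * H m N ks                              ≡⟨ cong₂ _*_ (^⁻-+ m 1 k′) (expand m 1≤m m<N) ⟩
      (m ⁻¹ * m ^⁻ k′) * S (reflectedSum N ks) m     ≡⟨ ℚ.*-assoc (m ⁻¹) (m ^⁻ k′) _ ⟩
      m ⁻¹ * (m ^⁻ k′ * S (reflectedSum N ks) m)     ≡⟨ cong (m ⁻¹ *_) (^⁻-*-sumBetween-κ k′ (reflectedSum N ks) m 1≤m) ⟩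
      m ⁻¹ * S t m                                   ≡⟨ sym (sumBetween-*ˡ 0 N (m ⁻¹) (λ j → κ m j * t j)) ⟩
      sumBetween 0 N (λ j → m ⁻¹ * (κ m j * t j))    ≡⟨ sumBetween-cong 0 N (λ j _ _ → sym (ℚ.*-assoc (m ⁻¹) (κ m j) (t j))) ⟩
      sumBetween 0 N (λ j → (m ⁻¹ * κ m j) * t j)    ∎

  connectorExpansion : ∀ ks → All (1 ≤_) ks → ConnectorExpansion ks
  connectorExpansion []       _            i 1≤i i<N = sym (begin
    sumBetween 0 N (λ j → κ i j * 1ℚ) ≡⟨ sumBetween-cong 0 N (λ j _ _ → ℚ.*-identityʳ (κ i j)) ⟩
    sumBetween 0 N (κ i)              ≡⟨ cong (λ M → sumBetween 0 M (κ i)) (sym (ℕ.suc-pred N {{ℕ.>-nonZero (ℕ.<-≤-trans 1≤i (ℕ.<⇒≤ i<N))}})) ⟩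
    sumBetween 0 (suc (ℕ.pred N)) (κ i) ≡⟨ sumBetween-κ i (ℕ.pred N) 1≤i ⟩
    ρ i (ℕ.pred N)                    ≡⟨ ρ-top i i<N ⟩
    1ℚ                                ∎)
    where open ≡-Reasoning
  connectorExpansion (k ∷ ks) (1≤k ∷ 1≤ks) i 1≤i i<N = begin
      H i N (k ∷ ks)
    ≡⟨ H-∷-ρ k ks 1≤k (connectorExpansion ks 1≤ks) i i<N ⟩
      sumBetween 0 N (λ j → ρ i (ℕ.pred j) * reflectedTerm k ks j)
    ≡⟨ sumBetween-cong 0 N (λ j 0<j _ → cong (_* reflectedTerm k ks j) (sym (ρ-as-sum j 0<j))) ⟩
      sumBetween 0 N (λ j → sumBetween 0 j (κ i) * reflectedTerm k ks j)
    ≡⟨ sym (sumBetween-triangle N (κ i) (reflectedTerm k ks)) ⟩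
      sumBetween 0 N (λ j → κ i j * reflectedSum N (k ∷ ks) j)
    ∎
    where
    open ≡-Reasoning
    ρ-as-sum : ∀ j → 0 < j → sumBetween 0 j (κ i) ≡ ρ i (ℕ.pred j)
    ρ-as-sum j 0<j = trans (cong (λ M → sumBetween 0 M (κ i)) (sym (ℕ.suc-pred j {{ℕ.>-nonZero 0<j}}))) (sumBetween-κ i (ℕ.pred j) 1≤i)

  -- ρ 0 x computes to 1, so at i = 0 the expansion of H-∷-ρ is the reflected sum itself.
  ζ<≡reflectedSum : ∀ k ks → All (1 ≤_) (k ∷ ks) → 0 < N → ζ< N (k ∷ ks) ≡ reflectedSum N (k ∷ ks) 0
  ζ<≡reflectedSum k ks (1≤k ∷ 1≤ks) 0<N = begin
    ζ< N (k ∷ ks)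
      ≡⟨ H-∷-ρ k ks 1≤k (connectorExpansion ks 1≤ks) 0 0<N ⟩
    sumBetween 0 N (λ j → ρ 0 (ℕ.pred j) * reflectedTerm k ks j)
      ≡⟨ sumBetween-cong 0 N (λ j _ _ → ℚ.*-identityˡ (reflectedTerm k ks j)) ⟩
    reflectedSum N (k ∷ ks) 0
      ∎
    where open ≡-Reasoning

-- Coarsenings

data IsComposition : List ℕ → Set where
  composition : ∀ {x xs} → 1 ≤ x → All (1 ≤_) xs → IsComposition (x ∷ xs)

coarsenings-isComposition : ∀ c → IsComposition c → All IsComposition (coarsenings c)
coarsenings-isComposition (x ∷ [])     c-comp = c-comp ∷ []
coarsenings-isComposition (x ∷ y ∷ ys) (composition 1≤x (1≤y ∷ 1≤ys)) =
  let tail-comp = coarsenings-isComposition (y ∷ ys) (composition 1≤y 1≤ys)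
  in Allₚ.++⁺ (Allₚ.map⁺ (All.map cons tail-comp)) (Allₚ.map⁺ (All.map merge tail-comp))
  where
  cons : ∀ {c} → IsComposition c → IsComposition (x ∷ c)
  cons (composition 1≤c 1≤cs) = composition 1≤x (1≤c ∷ 1≤cs)
  merge : ∀ {c} → IsComposition c → IsComposition (addHead x c)
  merge (composition {c} 1≤c 1≤cs) = composition (ℕ.≤-trans 1≤c (ℕ.m≤n+m c x)) 1≤cs

coarsenings-addHead : ∀ b c → coarsenings (addHead b c) ≡ map (addHead b) (coarsenings c)
coarsenings-addHead b []           = refl
coarsenings-addHead b (c ∷ [])     = refl
coarsenings-addHead b (c ∷ y ∷ ys) = sym (begin
    map (addHead b) (map (c ∷_) S ++ map (addHead c) S)
  ≡⟨ map-++ (addHead b) (map (c ∷_) S) (map (addHead c) S) ⟩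
    map (addHead b) (map (c ∷_) S) ++ map (addHead b) (map (addHead c) S)
  ≡⟨ cong₂ _++_ (sym (map-∘ S)) (trans (sym (map-∘ S)) (map-cong addHead-addHead S)) ⟩
    map ((b ℕ.+ c) ∷_) S ++ map (addHead (b ℕ.+ c)) S
  ∎)
  where
  open ≡-Reasoning
  S : List (List ℕ)
  S = coarsenings (y ∷ ys)
  addHead-addHead : ∀ z → addHead b (addHead c z) ≡ addHead (b ℕ.+ c) z
  addHead-addHead []       = refl
  addHead-addHead (z ∷ zs) = cong (_∷ zs) (sym (ℕ.+-assoc b c z))

module _ {b : ℕ} {S : List (List ℕ)} where

  ∈-map-addHead⁺ : ∀ {t T} → b ≤ t → (t ∸ b ∷ T) ∈ S → (t ∷ T) ∈ map (addHead b) S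
  ∈-map-addHead⁺ {T = T} b≤t mem = subst (λ x → (x ∷ T) ∈ map (addHead b) S) (ℕ.m+[n∸m]≡n b≤t) (∈-map⁺ (addHead b) mem)

  ∈-map-addHead⁻ : ∀ {t T} → All IsComposition S → (t ∷ T) ∈ map (addHead b) S → (t ∸ b ∷ T) ∈ S
  ∈-map-addHead⁻ S-comp mem with ∈-map⁻ (addHead b) mem
  ... | z ∷ zs , z∈S , refl = subst (λ x → (x ∷ zs) ∈ S) (sym (ℕ.m+n∸m≡n b z)) z∈S
  ... | []     , []∈S , _   with All.lookup S-comp []∈S
  ... | ()

  b∉map-addHead : ∀ {T} → All IsComposition S → (b ∷ T) ∉ map (addHead b) S
  b∉map-addHead S-comp mem with ∈-map⁻ (addHead b) mem
  ... | z ∷ zs , z∈S , b≡b+z with All.lookup S-comp z∈S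
  ...   | composition 1≤z _ = ℕ.<-irrefl (∷-injectiveˡ b≡b+z) (ℕ.m<m+n b 1≤z)
  b∉map-addHead S-comp mem | [] , []∈S , _ with All.lookup S-comp []∈S
  ... | ()

module _ {b : ℕ} {T : List ℕ} where

  ∈-coarsenings-∷ : ∀ {t c} → IsComposition c → b < t →
    (t ∷ T) ∈ coarsenings (b ∷ c) ⇔ (t ∸ b ∷ T) ∈ coarsenings c
  ∈-coarsenings-∷ {t} {c@(_ ∷ _)} c-comp b<t = mk⇔ to from
    where
    to : (t ∷ T) ∈ coarsenings (b ∷ c) → (t ∸ b ∷ T) ∈ coarsenings c
    to mem with ∈-++⁻ (map (b ∷_) (coarsenings c)) mem
    ... | inj₁ mem₁ = ⊥-elim (ℕ.<-irrefl (sym (proj₁ (map∷-decomp∈ mem₁))) b<t)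
    ... | inj₂ mem₂ = ∈-map-addHead⁻ (coarsenings-isComposition c c-comp) mem₂
    from : (t ∸ b ∷ T) ∈ coarsenings c → (t ∷ T) ∈ coarsenings (b ∷ c)
    from mem = ∈-++⁺ʳ (map (b ∷_) (coarsenings c)) (∈-map-addHead⁺ (ℕ.<⇒≤ b<t) mem)

  ∈-coarsenings-addHead : ∀ {t c} → IsComposition c → b < t →
    (t ∷ T) ∈ coarsenings (addHead b c) ⇔ (t ∸ b ∷ T) ∈ coarsenings c
  ∈-coarsenings-addHead {t} {c} c-comp b<t rewrite coarsenings-addHead b c =
    mk⇔ (∈-map-addHead⁻ (coarsenings-isComposition c c-comp)) (∈-map-addHead⁺ (ℕ.<⇒≤ b<t))

  head∈-coarsenings-∷ : ∀ {c} → IsComposition c → (b ∷ T) ∈ coarsenings (b ∷ c) ⇔ T ∈ coarsenings c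
  head∈-coarsenings-∷ {c@(_ ∷ _)} c-comp = mk⇔ to from
    where
    to : (b ∷ T) ∈ coarsenings (b ∷ c) → T ∈ coarsenings c
    to mem with ∈-++⁻ (map (b ∷_) (coarsenings c)) mem
    ... | inj₁ mem₁ = proj₂ (map∷-decomp∈ mem₁)
    ... | inj₂ mem₂ = ⊥-elim (b∉map-addHead (coarsenings-isComposition c c-comp) mem₂)
    from : T ∈ coarsenings c → (b ∷ T) ∈ coarsenings (b ∷ c)
    from mem = ∈-++⁺ˡ (∈-map⁺ (b ∷_) mem)

  head∉-coarsenings-addHead : ∀ {c} → IsComposition c → (b ∷ T) ∉ coarsenings (addHead b c)
  head∉-coarsenings-addHead {c} c-comp rewrite coarsenings-addHead b c =
    b∉map-addHead (coarsenings-isComposition c c-comp)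

filter-map : ∀ {A B : Set} {P : B → Set} {Q : A → Set} (P? : Decidable P) (Q? : Decidable Q) (g : A → B) {ys} →
  All (λ y → P (g y) ⇔ Q y) ys → filter P? (map g ys) ≡ map g (filter Q? ys)
filter-map P? Q? g []                  = refl
filter-map P? Q? g {y ∷ ys} (P⇔Q ∷ eqs) with Q? y
... | yes q = trans (filter-accept P? (Equivalence.from P⇔Q q)) (cong (g y ∷_) (filter-map P? Q? g eqs))
... | no ¬q = trans (filter-reject P? (¬q ∘ Equivalence.to P⇔Q)) (filter-map P? Q? g eqs)

map-concatMap-++ : ∀ {A : Set} (g : List A → List A) (zs : List (List A)) {cs} →
  All (λ c → ∀ z → g (c ++ z) ≡ g c ++ z) cs →
  map g (concatMap (λ c → map (c ++_) zs) cs) ≡ concatMap (λ c → map (c ++_) zs) (map g cs)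
map-concatMap-++ g zs {cs} g-++ = begin
  map g (concatMap (λ c → map (c ++_) zs) cs)        ≡⟨ map-concatMap g (λ c → map (c ++_) zs) cs ⟩
  concatMap (λ c → map g (map (c ++_) zs)) cs        ≡⟨ cong concat (map-cong-local (All.map (λ g-++ᶜ → trans (sym (map-∘ zs)) (map-cong g-++ᶜ zs)) g-++)) ⟩
  concatMap (λ c → map (g c ++_) zs) cs              ≡⟨ sym (concatMap-map (λ c → map (c ++_) zs) g cs) ⟩
  concatMap (λ c → map (c ++_) zs) (map g cs)        ∎
  where open ≡-Reasoning

filter-head∈coarsenings-∷ : ∀ b T {c} → IsComposition c →
  filter (λ m → (b ∷ T) ∈? coarsenings m) (coarsenings (b ∷ c)) ≡ map (b ∷_) (filter (λ m → T ∈? coarsenings m) (coarsenings c))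
filter-head∈coarsenings-∷ b T {c@(_ ∷ _)} c-comp = begin
    filter P? (map (b ∷_) S ++ map (addHead b) S)
  ≡⟨ filter-++ P? (map (b ∷_) S) (map (addHead b) S) ⟩
    filter P? (map (b ∷_) S) ++ filter P? (map (addHead b) S)
  ≡⟨ cong₂ _++_ (filter-map P? Q? (b ∷_) (All.map head∈-coarsenings-∷ S-comp))
                (filter-none P? (Allₚ.map⁺ (All.map head∉-coarsenings-addHead S-comp))) ⟩
    map (b ∷_) (filter Q? S) ++ []
  ≡⟨ ++-identityʳ _ ⟩
    map (b ∷_) (filter Q? S)
  ∎
  where
  open ≡-Reasoning
  S : List (List ℕ)
  S = coarsenings c
  S-comp : All IsComposition S
  S-comp = coarsenings-isComposition c c-comp
  P? : Decidable (λ m → (b ∷ T) ∈ coarsenings m)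
  P? m = (b ∷ T) ∈? coarsenings m
  Q? : Decidable (λ m → T ∈ coarsenings m)
  Q? m = T ∈? coarsenings m

filter-coarsenings-∷ : ∀ b t T {c} → IsComposition c → b < t →
  filter (λ m → (t ∷ T) ∈? coarsenings m) (coarsenings (b ∷ c))
  ≡ map (b ∷_) (filter (λ m → (t ∸ b ∷ T) ∈? coarsenings m) (coarsenings c))
    ++ map (addHead b) (filter (λ m → (t ∸ b ∷ T) ∈? coarsenings m) (coarsenings c))
filter-coarsenings-∷ b t T {c@(_ ∷ _)} c-comp b<t = begin
    filter P? (map (b ∷_) S ++ map (addHead b) S)
  ≡⟨ filter-++ P? (map (b ∷_) S) (map (addHead b) S) ⟩
    filter P? (map (b ∷_) S) ++ filter P? (map (addHead b) S)
  ≡⟨ cong₂ _++_ (filter-map P? Q? (b ∷_) (All.map (λ y-comp → ∈-coarsenings-∷ y-comp b<t) S-comp))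
                (filter-map P? Q? (addHead b) (All.map (λ y-comp → ∈-coarsenings-addHead y-comp b<t) S-comp)) ⟩
    map (b ∷_) (filter Q? S) ++ map (addHead b) (filter Q? S)
  ∎
  where
  open ≡-Reasoning
  S : List (List ℕ)
  S = coarsenings c
  S-comp : All IsComposition S
  S-comp = coarsenings-isComposition c c-comp
  P? : Decidable (λ m → (t ∷ T) ∈ coarsenings m)
  P? m = (t ∷ T) ∈? coarsenings m
  Q? : Decidable (λ m → (t ∸ b ∷ T) ∈ coarsenings m)
  Q? m = (t ∸ b ∷ T) ∈? coarsenings m

-- (b + j ∷ T) ⪯ m holds only if m never merges across the boundary between the block (b, 1^j) and R.
filter-coarsenings-block : ∀ j b R T → 1 ≤ b → All (1 ≤_) R →
  filter (λ m → (b ℕ.+ j ∷ T) ∈? coarsenings m) (coarsenings (b ∷ replicate j 1 ++ R))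
  ≡ concatMap (λ c → map (c ++_) (filter (λ m → T ∈? coarsenings m) (coarsenings R))) (coarsenings (b ∷ replicate j 1))
filter-coarsenings-block zero b [] [] _ _ =
  filter-accept (λ m → (b ℕ.+ 0 ∷ []) ∈? coarsenings m) (here (cong [_] (ℕ.+-identityʳ b)))
filter-coarsenings-block zero b [] (x ∷ xs) _ _ =
  filter-reject (λ m → (b ℕ.+ 0 ∷ x ∷ xs) ∈? coarsenings m) {x = [ b ]} {xs = []} (λ { (here ()) ; (there ()) })
filter-coarsenings-block zero b (r ∷ R) T 1≤b (1≤r ∷ 1≤R) rewrite ℕ.+-identityʳ b =
  trans (filter-head∈coarsenings-∷ b T (composition 1≤r 1≤R)) (sym (++-identityʳ _))
filter-coarsenings-block (suc j) b R T 1≤b 1≤R = begin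
    filter (λ m → (b ℕ.+ suc j ∷ T) ∈? coarsenings m) (coarsenings (b ∷ 1 ∷ replicate j 1 ++ R))
  ≡⟨ filter-coarsenings-∷ b (b ℕ.+ suc j) T (composition 1≤1 (Allₚ.++⁺ (Allₚ.replicate⁺ j 1≤1) 1≤R)) (ℕ.m<m+n b (s≤s z≤n)) ⟩
    map (b ∷_) (F (b ℕ.+ suc j ∸ b)) ++ map (addHead b) (F (b ℕ.+ suc j ∸ b))
  ≡⟨ cong (λ h → map (b ∷_) (F h) ++ map (addHead b) (F h)) (ℕ.m+n∸m≡n b (suc j)) ⟩
    map (b ∷_) (F (suc j)) ++ map (addHead b) (F (suc j))
  ≡⟨ cong (λ z → map (b ∷_) z ++ map (addHead b) z) (filter-coarsenings-block j 1 R T 1≤1 1≤R) ⟩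
    map (b ∷_) (concatMap G Cs) ++ map (addHead b) (concatMap G Cs)
  ≡⟨ cong₂ _++_ (map-concatMap-++ (b ∷_) Z (All.universal (λ _ _ → refl) Cs))
                (map-concatMap-++ (addHead b) Z (All.map (λ { (composition _ _) _ → refl }) Cs-comp)) ⟩
    concatMap G (map (b ∷_) Cs) ++ concatMap G (map (addHead b) Cs)
  ≡⟨ sym (concatMap-++ G (map (b ∷_) Cs) (map (addHead b) Cs)) ⟩
    concatMap G (coarsenings (b ∷ replicate (suc j) 1))
  ∎
  where
  open ≡-Reasoning
  1≤1 : 1 ≤ 1
  1≤1 = s≤s z≤n
  F : ℕ → List (List ℕ)
  F h = filter (λ m → (h ∷ T) ∈? coarsenings m) (coarsenings (1 ∷ replicate j 1 ++ R))
  Z Cs : List (List ℕ)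
  Z  = filter (λ m → T ∈? coarsenings m) (coarsenings R)
  Cs = coarsenings (1 ∷ replicate j 1)
  G : List ℕ → List (List ℕ)
  G c = map (c ++_) Z
  Cs-comp : All IsComposition Cs
  Cs-comp = coarsenings-isComposition (1 ∷ replicate j 1) (composition 1≤1 (Allₚ.replicate⁺ j 1≤1))

⊘-positive : ∀ l k → All (1 ≤_) (l ⊘ k)
⊘-positive []      k       = []
⊘-positive (_ ∷ _) []      = []
⊘-positive (a ∷ l) (b ∷ k) = Allₚ.++⁺ (s≤s z≤n ∷ Allₚ.replicate⁺ (b ∸ 1) (s≤s z≤n)) (⊘-positive l k)

between-∷ : ∀ l₁ l k₁ k → 1 ≤ k₁ →
  between (l₁ ∷ l) (k₁ ∷ k) ≡ concatMap (λ c → map (c ++_) (between l k)) (coarsenings (suc l₁ ∷ replicate (k₁ ∸ 1) 1))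
between-∷ l₁ l (suc k₁) k _ = subst Block (sym (ℕ.+-suc l₁ k₁))
  (filter-coarsenings-block k₁ (suc l₁) (l ⊘ k) (l ⊕ k) (s≤s z≤n) (⊘-positive l k))
  where
  Block : ℕ → Set
  Block h = filter (λ m → (h ∷ l ⊕ k) ∈? coarsenings m) (coarsenings (suc l₁ ∷ replicate k₁ 1 ++ l ⊘ k))
            ≡ concatMap (λ c → map (c ++_) (between l k)) (coarsenings (suc l₁ ∷ replicate k₁ 1))

module _ (N : ℕ) where

  nestedSum : List ℕ → (ℕ → ℚ) → ℕ → ℚ
  nestedTerm : List ℕ → (ℕ → ℚ) → ℕ → ℚ
  nestedSum []       g a = g a
  nestedSum (c ∷ cs) g a = sumBetween a N (nestedTerm (c ∷ cs) g)
  nestedTerm []       g n = 0ℚ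
  nestedTerm (c ∷ cs) g n = n ^⁻ c * nestedSum cs g n

  H-++ : ∀ c m a → H a N (c ++ m) ≡ nestedSum c (λ n → H n N m) a
  H-++ []       m a = refl
  H-++ (c ∷ cs) m a = trans (H-∷ a N c (cs ++ m)) (sumBetween-cong a N (λ n _ _ → cong (n ^⁻ c *_) (H-++ cs m n)))

  sumOver-nestedSum : ∀ {A : Set} (xs : List A) c (f : A → ℕ → ℚ) a →
    sumOver xs (λ x → nestedSum c (f x) a) ≡ nestedSum c (λ n → sumOver xs (λ x → f x n)) a
  sumOver-nestedSum xs []       f a = refl
  sumOver-nestedSum xs (c ∷ cs) f a = begin
    sumOver xs (λ x → sumBetween a N (λ n → n ^⁻ c * nestedSum cs (f x) n))
      ≡⟨ sym (sumBetween-sumOver-comm a N xs (λ x n → n ^⁻ c * nestedSum cs (f x) n)) ⟩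
    sumBetween a N (λ n → sumOver xs (λ x → n ^⁻ c * nestedSum cs (f x) n))
      ≡⟨ sumBetween-cong a N (λ n _ _ → trans (sumOver-*ˡ xs (n ^⁻ c) (λ x → nestedSum cs (f x) n))
                                              (cong (n ^⁻ c *_) (sumOver-nestedSum xs cs f n))) ⟩
    sumBetween a N (λ n → n ^⁻ c * nestedSum cs (λ n′ → sumOver xs (λ x → f x n′)) n)
      ∎
    where open ≡-Reasoning

  private
    nestedSum-composition : ∀ {cs} g a → All IsComposition cs →
      sumOver cs (λ c → nestedSum c g a) ≡ sumOver cs (λ c → sumBetween a N (nestedTerm c g))
    nestedSum-composition g a cs-comp = sumOver-congᴬ cs-comp (λ { (composition _ _) → refl })

  -- Summing strict chains over all coarsenings of (b, 1^j) produces the non-strict chains of harmonicTail^ j.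
  sumOver-coarsenings-nestedTerm : ∀ j b (g : ℕ → ℚ) n →
    sumOver (coarsenings (b ∷ replicate j 1)) (λ c → nestedTerm c g n) ≡ n ^⁻ b * harmonicTail^ N j g n
  sumOver-coarsenings-nestedTerm zero    b g n = ℚ.+-identityʳ _
  sumOver-coarsenings-nestedTerm (suc j) b g n = begin
      sumOver (map (b ∷_) Cs ++ map (addHead b) Cs) (λ c → nestedTerm c g n)
    ≡⟨ sumOver-++ (map (b ∷_) Cs) (map (addHead b) Cs) (λ c → nestedTerm c g n) ⟩
      sumOver (map (b ∷_) Cs) (λ c → nestedTerm c g n) + sumOver (map (addHead b) Cs) (λ c → nestedTerm c g n)
    ≡⟨ cong₂ _+_ (trans (sumOver-map (b ∷_) Cs (λ c → nestedTerm c g n)) unmerged)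
                 (trans (sumOver-map (addHead b) Cs (λ c → nestedTerm c g n)) merged) ⟩
      n ^⁻ b * sumBetween n N (λ n′ → n′ ⁻¹ * t n′) + n ^⁻ b * (n ⁻¹ * t n)
    ≡⟨ trans (sym (ℚ.*-distribˡ-+ (n ^⁻ b) (sumBetween n N (λ n′ → n′ ⁻¹ * t n′)) (n ⁻¹ * t n)))
         (cong (n ^⁻ b *_) (ℚ.+-comm (sumBetween n N (λ n′ → n′ ⁻¹ * t n′)) (n ⁻¹ * t n))) ⟩
      n ^⁻ b * harmonicTail^ N (suc j) g n
    ∎
    where
    open ≡-Reasoning
    Cs : List (List ℕ)
    Cs = coarsenings (1 ∷ replicate j 1)
    Cs-comp : All IsComposition Cs
    Cs-comp = coarsenings-isComposition _ (composition (s≤s z≤n) (Allₚ.replicate⁺ j (s≤s z≤n)))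
    t : ℕ → ℚ
    t = harmonicTail^ N j g
    unmerged : sumOver Cs (λ c → n ^⁻ b * nestedSum c g n) ≡ n ^⁻ b * sumBetween n N (λ n′ → n′ ⁻¹ * t n′)
    unmerged = begin
      sumOver Cs (λ c → n ^⁻ b * nestedSum c g n)                   ≡⟨ sumOver-*ˡ Cs (n ^⁻ b) (λ c → nestedSum c g n) ⟩
      n ^⁻ b * sumOver Cs (λ c → nestedSum c g n)                   ≡⟨ cong (n ^⁻ b *_) (nestedSum-composition g n Cs-comp) ⟩
      n ^⁻ b * sumOver Cs (λ c → sumBetween n N (nestedTerm c g))    ≡⟨ cong (n ^⁻ b *_) (sym (sumBetween-sumOver-comm n N Cs (λ c → nestedTerm c g))) ⟩
      n ^⁻ b * sumBetween n N (λ n′ → sumOver Cs (λ c → nestedTerm c g n′))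
        ≡⟨ cong (n ^⁻ b *_) (sumBetween-cong n N (λ n′ _ _ → sumOver-coarsenings-nestedTerm j 1 g n′)) ⟩
      n ^⁻ b * sumBetween n N (λ n′ → n′ ⁻¹ * t n′)                 ∎
    merged : sumOver Cs (λ c → nestedTerm (addHead b c) g n) ≡ n ^⁻ b * (n ⁻¹ * t n)
    merged = begin
      sumOver Cs (λ c → nestedTerm (addHead b c) g n)   ≡⟨ sumOver-congᴬ Cs-comp (λ { {c ∷ cs} (composition _ _) →
                                                             trans (cong (_* nestedSum cs g n) (^⁻-+ n b c)) (ℚ.*-assoc (n ^⁻ b) (n ^⁻ c) _) }) ⟩
      sumOver Cs (λ c → n ^⁻ b * nestedTerm c g n)      ≡⟨ sumOver-*ˡ Cs (n ^⁻ b) (λ c → nestedTerm c g n) ⟩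
      n ^⁻ b * sumOver Cs (λ c → nestedTerm c g n)      ≡⟨ cong (n ^⁻ b *_) (sumOver-coarsenings-nestedTerm j 1 g n) ⟩
      n ^⁻ b * (n ⁻¹ * t n)                             ∎

  sumOver-coarsenings-nestedSum : ∀ j b (g : ℕ → ℚ) a → 1 ≤ b →
    sumOver (coarsenings (b ∷ replicate j 1)) (λ c → nestedSum c g a) ≡ sumBetween a N (λ n → n ^⁻ b * harmonicTail^ N j g n)
  sumOver-coarsenings-nestedSum j b g a 1≤b = begin
    sumOver Cs (λ c → nestedSum c g a)                        ≡⟨ nestedSum-composition g a
                                                                   (coarsenings-isComposition _ (composition 1≤b (Allₚ.replicate⁺ j (s≤s z≤n)))) ⟩
    sumOver Cs (λ c → sumBetween a N (nestedTerm c g))         ≡⟨ sym (sumBetween-sumOver-comm a N Cs (λ c → nestedTerm c g)) ⟩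
    sumBetween a N (λ n → sumOver Cs (λ c → nestedTerm c g n)) ≡⟨ sumBetween-cong a N (λ n _ _ → sumOver-coarsenings-nestedTerm j b g n) ⟩
    sumBetween a N (λ n → n ^⁻ b * harmonicTail^ N j g n)      ∎
    where
    open ≡-Reasoning
    Cs : List (List ℕ)
    Cs = coarsenings (b ∷ replicate j 1)

  betweenSum : List ℕ → Index → ℕ → ℚ
  betweenSum l k a = sumOver (between l k) (λ m → H a N m)

  betweenSum-∷ : ∀ l₁ l k₁ k a → 1 ≤ k₁ →
    betweenSum (l₁ ∷ l) (k₁ ∷ k) a ≡ sumBetween a N (λ n → n ^⁻ suc l₁ * harmonicTail^ N (k₁ ∸ 1) (betweenSum l k) n)
  betweenSum-∷ l₁ l k₁ k a 1≤k₁ = begin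
    sumOver (between (l₁ ∷ l) (k₁ ∷ k)) (λ m → H a N m)          ≡⟨ cong (λ ms → sumOver ms (λ m → H a N m)) (between-∷ l₁ l k₁ k 1≤k₁) ⟩
    sumOver (concatMap F Cs) (λ m → H a N m)                     ≡⟨ sumOver-concatMap F Cs (λ m → H a N m) ⟩
    sumOver Cs (λ c → sumOver (map (c ++_) Bs) (λ m → H a N m))  ≡⟨ sumOver-cong Cs (λ c → sumOver-map (c ++_) Bs (λ m → H a N m)) ⟩
    sumOver Cs (λ c → sumOver Bs (λ m → H a N (c ++ m)))         ≡⟨ sumOver-cong Cs (λ c → sumOver-cong Bs (λ m → H-++ c m a)) ⟩
    sumOver Cs (λ c → sumOver Bs (λ m → nestedSum c (λ n → H n N m) a))
                                                                 ≡⟨ sumOver-cong Cs (λ c → sumOver-nestedSum Bs c (λ m n → H n N m) a) ⟩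
    sumOver Cs (λ c → nestedSum c (betweenSum l k) a)            ≡⟨ sumOver-coarsenings-nestedSum (k₁ ∸ 1) (suc l₁) (betweenSum l k) a (s≤s z≤n) ⟩
    sumBetween a N (λ n → n ^⁻ suc l₁ * harmonicTail^ N (k₁ ∸ 1) (betweenSum l k) n) ∎
    where
    open ≡-Reasoning
    Bs Cs : List (List ℕ)
    Bs = between l k
    Cs = coarsenings (suc l₁ ∷ replicate (k₁ ∸ 1) 1)
    F : List ℕ → List (List ℕ)
    F c = map (c ++_) Bs

-- Partial sums of the p-adic series

sgn-*-sgn : ∀ r → sgn r * sgn r ≡ 1ℚ
sgn-*-sgn zero    = refl
sgn-*-sgn (suc r) = trans (solve 1 (λ x → (:- x) :* (:- x) := x :* x) refl (sgn r)) (sgn-*-sgn r)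

sumOver-comps-suc : ∀ r i (f : List ℕ → ℚ) →
  sumOver (comps (suc r) i) f ≡ sumBelow (suc i) (λ j → sumOver (comps r (i ∸ j)) (λ l → f (j ∷ l)))
sumOver-comps-suc r i f = begin
  sumOver (concatMap (λ j → map (j ∷_) (comps r (i ∸ j))) (upTo (suc i))) f
    ≡⟨ sumOver-concatMap (λ j → map (j ∷_) (comps r (i ∸ j))) (upTo (suc i)) f ⟩
  sumOver (upTo (suc i)) (λ j → sumOver (map (j ∷_) (comps r (i ∸ j))) f)
    ≡⟨ sumOver-cong (upTo (suc i)) (λ j → sumOver-map (j ∷_) (comps r (i ∸ j)) f) ⟩
  sumOver (upTo (suc i)) (λ j → sumOver (comps r (i ∸ j)) (λ l → f (j ∷ l)))
    ≡⟨ sumOver-upTo (suc i) (λ j → sumOver (comps r (i ∸ j)) (λ l → f (j ∷ l))) ⟩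
  sumBelow (suc i) (λ j → sumOver (comps r (i ∸ j)) (λ l → f (j ∷ l)))
    ∎
  where open ≡-Reasoning

module PartialSums (N : ℕ) where

  private
    L : ℕ → (ℕ → ℚ) → ℕ → ℚ
    L = harmonicTail^ N
    module L e = IsLinear (harmonicTail^-linear N e)

  N^ : ℕ → ℚ
  N^ i = ℕ→ℚ (N ^ i)

  N^-split : ∀ {i j} → j ≤ i → N^ i ≡ N^ j * N^ (i ∸ j)
  N^-split {i} {j} j≤i = trans (cong (ℕ→ℚ ∘ (N ^_)) (sym (ℕ.m+[n∸m]≡n j≤i)))
                               (trans (cong ℕ→ℚ (ℕ.^-distribˡ-+-* N j (i ∸ j))) (ℕ→ℚ-* (N ^ j) (N ^ (i ∸ j))))

  coefficient : Index → ℕ → ℕ → ℚ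
  coefficient k i a = sumOver (comps (length k) i) (λ l → betweenSum N l k a)

  partialSum : ℕ → Index → ℕ → ℚ
  partialSum T k a = sumBelow T (λ i → coefficient k i a * N^ i)

  partialSum-[] : ∀ T a → partialSum (suc T) [] a ≡ 1ℚ
  partialSum-[] T a = begin
    sumBelow (suc T) (λ i → coefficient [] i a * N^ i)
      ≡⟨ sumBelow-split T (λ i → coefficient [] i a * N^ i) ⟩
    coefficient [] 0 a * N^ 0 + sumBelow T (λ i → coefficient [] (suc i) a * N^ (suc i))
      ≡⟨ cong (1ℚ +_) (trans (sumBelow-cong T (λ i _ → ℚ.*-zeroˡ (N^ (suc i)))) (sumBelow-0ℚ T)) ⟩
    1ℚ + 0ℚ
      ≡⟨ ℚ.+-identityʳ 1ℚ ⟩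
    1ℚ
      ∎
    where open ≡-Reasoning

  module _ (n : ℕ) (1≤n : 1 ≤ n) (n<N : n < N) where

    ⁻¹-+-⁻¹ : (N ∸ n) ⁻¹ + n ⁻¹ ≡ (ℕ→ℚ N * n ⁻¹) * (N ∸ n) ⁻¹
    ⁻¹-+-⁻¹ = sym (begin
      (ℕ→ℚ N * n ⁻¹) * q                              ≡⟨ cong (λ x → (x * n ⁻¹) * q) (trans (cong ℕ→ℚ (sym (ℕ.m+[n∸m]≡n (ℕ.<⇒≤ n<N))))
                                                                                            (ℕ→ℚ-+ n (N ∸ n))) ⟩
      ((ℕ→ℚ n + ℕ→ℚ (N ∸ n)) * n ⁻¹) * q              ≡⟨ solve 4 (λ a b u v → ((a :+ b) :* u) :* v := (a :* u) :* v :+ (b :* v) :* u)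
                                                            refl (ℕ→ℚ n) (ℕ→ℚ (N ∸ n)) (n ⁻¹) q ⟩
      (ℕ→ℚ n * n ⁻¹) * q + (ℕ→ℚ (N ∸ n) * q) * n ⁻¹   ≡⟨ cong₂ (λ x y → x * q + y * n ⁻¹) (ℕ→ℚ-*-⁻¹ n 1≤n) (ℕ→ℚ-*-⁻¹ (N ∸ n) (ℕ.m<n⇒0<n∸m n<N)) ⟩
      1ℚ * q + 1ℚ * n ⁻¹                              ≡⟨ cong₂ _+_ (ℚ.*-identityˡ q) (ℚ.*-identityˡ (n ⁻¹)) ⟩
      q + n ⁻¹                                        ∎)
      where
      open ≡-Reasoning
      q : ℚ
      q = (N ∸ n) ⁻¹

    geometric : ∀ T → sumBelow T (λ j → N^ j * n ^⁻ suc j) + (N ∸ n) ⁻¹ ≡ (N^ T * n ^⁻ T) * (N ∸ n) ⁻¹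
    geometric zero    = trans (cong (_+ q) (sumBelow-empty _)) (trans (ℚ.+-identityˡ q) (sym (ℚ.*-identityˡ q)))
      where
      q : ℚ
      q = (N ∸ n) ⁻¹
    geometric (suc T) = begin
      sumBelow (suc T) g + q                       ≡⟨ cong (_+ q) (sumBelow-suc T g) ⟩
      (sumBelow T g + N^ T * n ^⁻ suc T) + q       ≡⟨ solve 3 (λ a b c → (a :+ b) :+ c := (a :+ c) :+ b) refl (sumBelow T g) (N^ T * n ^⁻ suc T) q ⟩
      (sumBelow T g + q) + N^ T * n ^⁻ suc T       ≡⟨ cong₂ _+_ (geometric T) (cong (N^ T *_) (^⁻-+ n 1 T)) ⟩
      (N^ T * n ^⁻ T) * q + N^ T * (n ⁻¹ * n ^⁻ T) ≡⟨ solve 4 (λ a b c d → (a :* b) :* c :+ a :* (d :* b) := (a :* b) :* (c :+ d))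
                                                        refl (N^ T) (n ^⁻ T) q (n ⁻¹) ⟩
      (N^ T * n ^⁻ T) * (q + n ⁻¹)                 ≡⟨ cong ((N^ T * n ^⁻ T) *_) ⁻¹-+-⁻¹ ⟩
      (N^ T * n ^⁻ T) * ((ℕ→ℚ N * n ⁻¹) * q)       ≡⟨ solve 5 (λ a b c d e → (a :* b) :* ((c :* d) :* e) := ((c :* a) :* (d :* b)) :* e)
                                                        refl (N^ T) (n ^⁻ T) (ℕ→ℚ N) (n ⁻¹) q ⟩
      ((ℕ→ℚ N * N^ T) * (n ⁻¹ * n ^⁻ T)) * q       ≡⟨ cong₂ (λ a b → (a * b) * q) (sym (ℕ→ℚ-* N (N ^ T))) (sym (^⁻-+ n 1 T)) ⟩
      (N^ (suc T) * n ^⁻ suc T) * q                ∎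
      where
      open ≡-Reasoning
      q : ℚ
      q = (N ∸ n) ⁻¹
      g : ℕ → ℚ
      g j = N^ j * n ^⁻ suc j

  module Cons (k₁ : ℕ) (k : Index) (a : ℕ) (1≤k₁ : 1 ≤ k₁) where

    e : ℕ
    e = k₁ ∸ 1

    σ : ℚ
    σ = sgn (length k)

    W : ℕ → ℚ
    W = L e (reflectedSum N k)

    error : ℕ → ℕ → ℚ
    error T x = partialSum T k x - σ * reflectedSum N k x

    E : ℕ → ℕ → ℚ
    E T j = sumBetween a N (λ n → n ^⁻ suc j * L e (error (T ∸ j)) n)

    B : ℕ → ℚ
    B j = sumBetween a N (λ n → n ^⁻ suc j * W n)

    headCoefficient : ℕ → ℕ → ℚ
    headCoefficient j i = sumOver (comps (length k) i) (λ l → betweenSum N (j ∷ l) (k₁ ∷ k) a)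

    headCoefficient≡sumBetween : ∀ j i → headCoefficient j i ≡ sumBetween a N (λ n → n ^⁻ suc j * L e (coefficient k i) n)
    headCoefficient≡sumBetween j i = begin
      sumOver ls (λ l → betweenSum N (j ∷ l) (k₁ ∷ k) a)
        ≡⟨ sumOver-cong ls (λ l → betweenSum-∷ N j l k₁ k a 1≤k₁) ⟩
      sumOver ls (λ l → sumBetween a N (λ n → n ^⁻ suc j * L e (betweenSum N l k) n))
        ≡⟨ sym (sumBetween-sumOver-comm a N ls (λ l n → n ^⁻ suc j * L e (betweenSum N l k) n)) ⟩
      sumBetween a N (λ n → sumOver ls (λ l → n ^⁻ suc j * L e (betweenSum N l k) n))
        ≡⟨ sumBetween-cong a N (λ n _ _ → trans (sumOver-*ˡ ls (n ^⁻ suc j) (λ l → L e (betweenSum N l k) n))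
                                                (cong (n ^⁻ suc j *_) (sym (L.sumOver-homo e ls (λ l → betweenSum N l k) n)))) ⟩
      sumBetween a N (λ n → n ^⁻ suc j * L e (coefficient k i) n)
        ∎
      where
      open ≡-Reasoning
      ls : List (List ℕ)
      ls = comps (length k) i

    sumBelow-headCoefficient : ∀ j M → sumBelow M (λ i → headCoefficient j i * N^ i) ≡ sumBetween a N (λ n → n ^⁻ suc j * L e (partialSum M k) n)
    sumBelow-headCoefficient j M = begin
      sumBelow M (λ i → headCoefficient j i * N^ i)
        ≡⟨ sumBelow-cong M (λ i _ → trans (cong (_* N^ i) (headCoefficient≡sumBetween j i)) (sym (sumBetween-*ʳ a N (N^ i) (t i)))) ⟩
      sumBelow M (λ i → sumBetween a N (λ n → t i n * N^ i))
        ≡⟨ sumBelow-sumBetween-comm M a N (λ i n → t i n * N^ i) ⟩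
      sumBetween a N (λ n → sumBelow M (λ i → t i n * N^ i))
        ≡⟨ sumBetween-cong a N (λ n _ _ → pointwise n) ⟩
      sumBetween a N (λ n → n ^⁻ suc j * L e (partialSum M k) n)
        ∎
      where
      open ≡-Reasoning
      t : ℕ → ℕ → ℚ
      t i n = n ^⁻ suc j * L e (coefficient k i) n
      pointwise : ∀ n → sumBelow M (λ i → t i n * N^ i) ≡ n ^⁻ suc j * L e (partialSum M k) n
      pointwise n = begin
        sumBelow M (λ i → t i n * N^ i)                                ≡⟨ sumBelow-cong M (λ i _ → ℚ.*-assoc (n ^⁻ suc j) _ (N^ i)) ⟩
        sumBelow M (λ i → n ^⁻ suc j * (L e (coefficient k i) n * N^ i)) ≡⟨ sumBelow-*ˡ M (n ^⁻ suc j) _ ⟩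
        n ^⁻ suc j * sumBelow M (λ i → L e (coefficient k i) n * N^ i)  ≡⟨ cong (n ^⁻ suc j *_) (sumBelow-cong M (λ i _ → sym (L.*ʳ-homo e (N^ i) (coefficient k i) n))) ⟩
        n ^⁻ suc j * sumBelow M (λ i → L e (λ x → coefficient k i x * N^ i) n)
                                                                       ≡⟨ cong (n ^⁻ suc j *_) (sym (L.sumBelow-homo e M (λ i x → coefficient k i x * N^ i) n)) ⟩
        n ^⁻ suc j * L e (partialSum M k) n                            ∎

    partialSum-∷ : ∀ T → partialSum T (k₁ ∷ k) a ≡
      sumBelow T (λ j → N^ j * sumBetween a N (λ n → n ^⁻ suc j * L e (partialSum (T ∸ j) k) n))
    partialSum-∷ T = begin
      sumBelow T (λ i → coefficient (k₁ ∷ k) i a * N^ i)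
        ≡⟨ sumBelow-cong T (λ i _ → cong (_* N^ i) (sumOver-comps-suc (length k) i (λ l → betweenSum N l (k₁ ∷ k) a))) ⟩
      sumBelow T (λ i → sumBelow (suc i) (λ j → headCoefficient j (i ∸ j)) * N^ i)
        ≡⟨ sumBelow-cong T (λ i _ → trans (sym (sumBelow-*ʳ (suc i) (N^ i) (λ j → headCoefficient j (i ∸ j))))
                                          (sumBelow-cong (suc i) (λ j j≤i → split (ℕ.≤-pred j≤i)))) ⟩
      sumBelow T (λ i → sumBelow (suc i) (λ j → h j (i ∸ j)))
        ≡⟨ sumBelow-antidiagonal T h ⟩
      sumBelow T (λ j → sumBelow (T ∸ j) (h j))
        ≡⟨ sumBelow-cong T (λ j _ → trans (sumBelow-*ˡ (T ∸ j) (N^ j) (λ i → headCoefficient j i * N^ i)) (cong (N^ j *_) (sumBelow-headCoefficient j (T ∸ j)))) ⟩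
      sumBelow T (λ j → N^ j * sumBetween a N (λ n → n ^⁻ suc j * L e (partialSum (T ∸ j) k) n))
        ∎
      where
      open ≡-Reasoning
      h : ℕ → ℕ → ℚ
      h j i = N^ j * (headCoefficient j i * N^ i)
      split : ∀ {i j} → j ≤ i → headCoefficient j (i ∸ j) * N^ i ≡ h j (i ∸ j)
      split {i} {j} j≤i = trans (cong (headCoefficient j (i ∸ j) *_) (N^-split j≤i))
        (x∙yz≈y∙xz (headCoefficient j (i ∸ j)) (N^ j) (N^ (i ∸ j)))

    sumBetween-partialSum-split : ∀ T j → sumBetween a N (λ n → n ^⁻ suc j * L e (partialSum (T ∸ j) k) n) ≡ E T j + σ * B j
    sumBetween-partialSum-split T j = begin
      sumBetween a N (λ n → n ^⁻ suc j * L e (partialSum (T ∸ j) k) n)      ≡⟨ sumBetween-cong a N (λ n _ _ → pointwise n) ⟩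
      sumBetween a N (λ n → n ^⁻ suc j * L e D n + σ * (n ^⁻ suc j * W n)) ≡⟨ sumBetween-+ a N (λ n → n ^⁻ suc j * L e D n) (λ n → σ * (n ^⁻ suc j * W n)) ⟩
      E T j + sumBetween a N (λ n → σ * (n ^⁻ suc j * W n))               ≡⟨ cong (E T j +_) (sumBetween-*ˡ a N σ (λ n → n ^⁻ suc j * W n)) ⟩
      E T j + σ * B j                                                     ∎
      where
      open ≡-Reasoning
      D : ℕ → ℚ
      D = error (T ∸ j)
      D+σs≡partialSum : ∀ x → D x + σ * reflectedSum N k x ≡ partialSum (T ∸ j) k x
      D+σs≡partialSum x = solve 2 (λ P R → (P :- R) :+ R := P) refl (partialSum (T ∸ j) k x) (σ * reflectedSum N k x)
      pointwise : ∀ n → n ^⁻ suc j * L e (partialSum (T ∸ j) k) n ≡ n ^⁻ suc j * L e D n + σ * (n ^⁻ suc j * W n)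
      pointwise n = begin
        n ^⁻ suc j * L e (partialSum (T ∸ j) k) n                      ≡⟨ cong (n ^⁻ suc j *_) (sym (L.cong-≗ e D+σs≡partialSum n)) ⟩
        n ^⁻ suc j * L e (λ x → D x + σ * reflectedSum N k x) n        ≡⟨ cong (n ^⁻ suc j *_) (L.+-homo e D (λ x → σ * reflectedSum N k x) n) ⟩
        n ^⁻ suc j * (L e D n + L e (λ x → σ * reflectedSum N k x) n)  ≡⟨ cong (λ y → n ^⁻ suc j * (L e D n + y)) (L.*-homo e σ (reflectedSum N k) n) ⟩
        n ^⁻ suc j * (L e D n + σ * W n)                               ≡⟨ ℚ.*-distribˡ-+ (n ^⁻ suc j) (L e D n) (σ * W n) ⟩
        n ^⁻ suc j * L e D n + n ^⁻ suc j * (σ * W n)                  ≡⟨ cong (n ^⁻ suc j * L e D n +_) (x∙yz≈y∙xz (n ^⁻ suc j) σ (W n)) ⟩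
        n ^⁻ suc j * L e D n + σ * (n ^⁻ suc j * W n)                  ∎

    sumBelow-B+reflectedSum : ∀ T →
      sumBelow T (λ j → N^ j * B j) + reflectedSum N (k₁ ∷ k) a ≡ sumBetween a N (λ n → ((N^ T * n ^⁻ T) * (N ∸ n) ⁻¹) * W n)
    sumBelow-B+reflectedSum T = begin
      sumBelow T (λ j → N^ j * B j) + sumBetween a N (λ n → (N ∸ n) ⁻¹ * W n)
        ≡⟨ cong (_+ sumBetween a N (λ n → (N ∸ n) ⁻¹ * W n))
                (trans (sumBelow-cong T (λ j _ → sym (sumBetween-*ˡ a N (N^ j) (λ n → n ^⁻ suc j * W n))))
                       (sumBelow-sumBetween-comm T a N (λ j n → N^ j * (n ^⁻ suc j * W n)))) ⟩
      sumBetween a N (λ n → sumBelow T (λ j → N^ j * (n ^⁻ suc j * W n))) + sumBetween a N (λ n → (N ∸ n) ⁻¹ * W n)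
        ≡⟨ sym (sumBetween-+ a N (λ n → sumBelow T (λ j → N^ j * (n ^⁻ suc j * W n))) (λ n → (N ∸ n) ⁻¹ * W n)) ⟩
      sumBetween a N (λ n → sumBelow T (λ j → N^ j * (n ^⁻ suc j * W n)) + (N ∸ n) ⁻¹ * W n)
        ≡⟨ sumBetween-cong a N (λ n a<n n<N → pointwise n (ℕ.<-≤-trans (s≤s z≤n) a<n) n<N) ⟩
      sumBetween a N (λ n → ((N^ T * n ^⁻ T) * (N ∸ n) ⁻¹) * W n)
        ∎
      where
      open ≡-Reasoning
      pointwise : ∀ n → 1 ≤ n → n < N →
        sumBelow T (λ j → N^ j * (n ^⁻ suc j * W n)) + (N ∸ n) ⁻¹ * W n ≡ ((N^ T * n ^⁻ T) * (N ∸ n) ⁻¹) * W n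
      pointwise n 1≤n n<N = begin
        sumBelow T (λ j → N^ j * (n ^⁻ suc j * W n)) + (N ∸ n) ⁻¹ * W n
          ≡⟨ cong (_+ (N ∸ n) ⁻¹ * W n) (trans (sumBelow-cong T (λ j _ → sym (ℚ.*-assoc (N^ j) (n ^⁻ suc j) (W n))))
                                                (sumBelow-*ʳ T (W n) (λ j → N^ j * n ^⁻ suc j))) ⟩
        sumBelow T (λ j → N^ j * n ^⁻ suc j) * W n + (N ∸ n) ⁻¹ * W n
          ≡⟨ sym (ℚ.*-distribʳ-+ (W n) (sumBelow T (λ j → N^ j * n ^⁻ suc j)) ((N ∸ n) ⁻¹)) ⟩
        (sumBelow T (λ j → N^ j * n ^⁻ suc j) + (N ∸ n) ⁻¹) * W n
          ≡⟨ cong (_* W n) (geometric n 1≤n n<N T) ⟩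
        ((N^ T * n ^⁻ T) * (N ∸ n) ⁻¹) * W n
          ∎

    partialSum-∷-error : ∀ T →
      partialSum T (k₁ ∷ k) a - sgn (length (k₁ ∷ k)) * reflectedSum N (k₁ ∷ k) a ≡
        sumBelow T (λ j → N^ j * E T j) + σ * sumBetween a N (λ n → ((N^ T * n ^⁻ T) * (N ∸ n) ⁻¹) * W n)
    partialSum-∷-error T = begin
        partialSum T (k₁ ∷ k) a - (- σ) * S
      ≡⟨ cong (_- (- σ) * S) (trans (partialSum-∷ T) (sumBelow-cong T (λ j _ → cong (N^ j *_) (sumBetween-partialSum-split T j)))) ⟩
        sumBelow T (λ j → N^ j * (E T j + σ * B j)) - (- σ) * S
      ≡⟨ cong (_- (- σ) * S) (trans (sumBelow-cong T (λ j _ → ℚ.*-distribˡ-+ (N^ j) (E T j) (σ * B j)))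
                                    (sumBelow-+ T (λ j → N^ j * E T j) (λ j → N^ j * (σ * B j)))) ⟩
        (sumBelow T (λ j → N^ j * E T j) + sumBelow T (λ j → N^ j * (σ * B j))) - (- σ) * S
      ≡⟨ cong (λ x → (sumBelow T (λ j → N^ j * E T j) + x) - (- σ) * S)
              (trans (sumBelow-cong T (λ j _ → x∙yz≈y∙xz (N^ j) σ (B j))) (sumBelow-*ˡ T σ (λ j → N^ j * B j))) ⟩
        (sumBelow T (λ j → N^ j * E T j) + σ * sumBelow T (λ j → N^ j * B j)) - (- σ) * S
      ≡⟨ solve 4 (λ x σ y S → (x :+ σ :* y) :- (:- σ) :* S := x :+ σ :* (y :+ S)) refl
           (sumBelow T (λ j → N^ j * E T j)) σ (sumBelow T (λ j → N^ j * B j)) S ⟩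
        sumBelow T (λ j → N^ j * E T j) + σ * (sumBelow T (λ j → N^ j * B j) + S)
      ≡⟨ cong (λ x → sumBelow T (λ j → N^ j * E T j) + σ * x) (sumBelow-B+reflectedSum T) ⟩
        sumBelow T (λ j → N^ j * E T j) + σ * sumBetween a N (λ n → ((N^ T * n ^⁻ T) * (N ∸ n) ⁻¹) * W n)
      ∎
      where
      open ≡-Reasoning
      S : ℚ
      S = reflectedSum N (k₁ ∷ k) a

-- p-adic estimates

module PAdic (p : ℕ) (p-prime : Prime p) where

  open PartialSums p

  instance
    p≢0 : ℕ.NonZero p
    p≢0 = prime⇒nonZero p-prime

  1<p : 1 < p
  1<p = ℕ.nonTrivial⇒n>1 p {{prime⇒nonTrivial p-prime}}

  p∤1 : ¬ p ∣ 1
  p∤1 p∣1 = ℕ.<⇒≱ 1<p (∣⇒≤ p∣1)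

  p∤[1+m] : ∀ {m} → suc m < p → ¬ p ∣ suc m
  p∤[1+m] 1+m<p p∣1+m = ℕ.<⇒≱ 1+m<p (∣⇒≤ p∣1+m)

  p∤m⇒p∤m^k : ∀ {m} k → ¬ p ∣ m → ¬ p ∣ m ^ k
  p∤m⇒p∤m^k zero    p∤m = p∤1
  p∤m⇒p∤m^k {m} (suc k) p∤m p∣m^[1+k] with euclidsLemma m (m ^ k) p-prime p∣m^[1+k]
  ... | inj₁ p∣m   = p∤m p∣m
  ... | inj₂ p∣m^k = p∤m⇒p∤m^k k p∤m p∣m^k

  p^n∣m*k⇒p^n∣m : ∀ n m k → p ^ n ∣ m ℕ.* k → ¬ p ∣ k → p ^ n ∣ m
  p^n∣m*k⇒p^n∣m zero    m k _ _ = 1∣ m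
  p^n∣m*k⇒p^n∣m (suc n) m k p^[1+n]∣mk p∤k with euclidsLemma m k p-prime (∣-trans (m∣m*n (p ^ n)) p^[1+n]∣mk)
  ... | inj₂ p∣k = ⊥-elim (p∤k p∣k)
  ... | inj₁ (divides q refl) = ∣-trans (*-monoʳ-∣ p (p^n∣m*k⇒p^n∣m n q k p^n∣qk p∤k)) (∣-reflexive (ℕ.*-comm p q))
    where
    p^n∣qk : p ^ n ∣ q ℕ.* k
    p^n∣qk = *-cancelˡ-∣ p (subst (p ℕ.* p ^ n ∣_) (regroup q p k) p^[1+n]∣mk)
      where
      regroup : ∀ q p k → q ℕ.* p ℕ.* k ≡ p ℕ.* (q ℕ.* k)
      regroup = solve-∀

  p^m∣p^n : ∀ {m n} → m ≤ n → p ^ m ∣ p ^ n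
  p^m∣p^n {m} {n} m≤n = divides (p ^ (n ∸ m)) (trans (cong (p ^_) (sym (ℕ.m∸n+n≡m m≤n))) (ℕ.^-distribˡ-+-* p (n ∸ m) m))

  -- x ∈ p^n ℤ₍ₚ₎, witnessed by a (not necessarily reduced) fraction a / (1 + b)
  infix 4 p^_∣ℚ_
  record p^_∣ℚ_ (n : ℕ) (x : ℚ) : Set where
    constructor fraction
    field
      numerator    : ℤ.ℤ
      denominator∸1 : ℕ
      ≃-fraction   : toℚᵘ x ≃ᵘ mkℚᵘ numerator denominator∸1
      p^n∣numerator : p ^ n ∣ ℤ.∣ numerator ∣
      p∤denominator : ¬ p ∣ suc denominator∸1

  p^n∣ℚ0 : ∀ n → p^ n ∣ℚ 0ℚ
  p^n∣ℚ0 n = fraction (ℤ.+ 0) 0 ℚᵘ.≃-refl ((p ^ n) ∣0) p∤1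

  p^0∣ℚℕ : ∀ k → p^ 0 ∣ℚ ℕ→ℚ k
  p^0∣ℚℕ k = fraction (ℤ.+ k) 0 (toℚᵘ-ℕ→ℚ k) (1∣ k) p∤1

  p^i∣ℚp^i : ∀ i → p^ i ∣ℚ ℕ→ℚ (p ^ i)
  p^i∣ℚp^i i = fraction (ℤ.+ (p ^ i)) 0 (toℚᵘ-ℕ→ℚ (p ^ i)) ∣-refl p∤1

  ∣ℚ-+ : ∀ {n x y} → p^ n ∣ℚ x → p^ n ∣ℚ y → p^ n ∣ℚ (x + y)
  ∣ℚ-+ {n} {x} {y} (fraction a b x≃a/b p^n∣a p∤b) (fraction c d y≃c/d p^n∣c p∤d) = fraction
    (a ℤ.* ℤ.+ suc d ℤ.+ c ℤ.* ℤ.+ suc b) (d ℕ.+ b ℕ.* suc d)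
    (ℚᵘ.≃-trans (ℚ.toℚᵘ-homo-+ x y) (ℚᵘ.+-cong x≃a/b y≃c/d))
    (ℤ∣.∣⇒∣ᵤ (ℤ∣.∣m∣n⇒∣m+n (ℤ∣.∣m⇒∣m*n (ℤ.+ suc d) (ℤ∣.∣ᵤ⇒∣ {k = ℤ.+ (p ^ n)} {i = a} p^n∣a))
                           (ℤ∣.∣m⇒∣m*n (ℤ.+ suc b) (ℤ∣.∣ᵤ⇒∣ {k = ℤ.+ (p ^ n)} {i = c} p^n∣c))))
    (λ p∣bd → Sum.[ p∤b , p∤d ] (euclidsLemma (suc b) (suc d) p-prime p∣bd))

  ∣ℚ-neg : ∀ {n x} → p^ n ∣ℚ x → p^ n ∣ℚ (- x)
  ∣ℚ-neg {n} {x} (fraction a b x≃a/b p^n∣a p∤b) =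
    fraction (ℤ.- a) b (ℚᵘ.≃-trans (ℚ.toℚᵘ-homo‿- x) (ℚᵘ.-‿cong x≃a/b)) (subst (p ^ n ∣_) (sym (ℤ.∣-i∣≡∣i∣ a)) p^n∣a) p∤b

  ∣ℚ-- : ∀ {n x y} → p^ n ∣ℚ x → p^ n ∣ℚ y → p^ n ∣ℚ (x - y)
  ∣ℚ-- p^n∣x p^n∣y = ∣ℚ-+ p^n∣x (∣ℚ-neg p^n∣y)

  ∣ℚ-* : ∀ {m n x y} → p^ m ∣ℚ x → p^ n ∣ℚ y → p^ (m ℕ.+ n) ∣ℚ (x * y)
  ∣ℚ-* {m} {n} {x} {y} (fraction a b x≃a/b p^m∣a p∤b) (fraction c d y≃c/d p^n∣c p∤d) = fraction
    (a ℤ.* c) (d ℕ.+ b ℕ.* suc d)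
    (ℚᵘ.≃-trans (ℚ.toℚᵘ-homo-* x y) (ℚᵘ.*-cong x≃a/b y≃c/d))
    (subst₂ _∣_ (sym (ℕ.^-distribˡ-+-* p m n)) (sym (ℤ.abs-* a c)) (*-pres-∣ p^m∣a p^n∣c))
    (λ p∣bd → Sum.[ p∤b , p∤d ] (euclidsLemma (suc b) (suc d) p-prime p∣bd))

  ∣ℚ-*ʳ : ∀ {n x y} → p^ n ∣ℚ x → p^ 0 ∣ℚ y → p^ n ∣ℚ (x * y)
  ∣ℚ-*ʳ {n} {x} {y} p^n∣x p^0∣y = subst (λ t → p^ t ∣ℚ (x * y)) (ℕ.+-identityʳ n) (∣ℚ-* p^n∣x p^0∣y)

  ∣ℚ-weaken : ∀ {m n x} → m ≤ n → p^ n ∣ℚ x → p^ m ∣ℚ x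
  ∣ℚ-weaken m≤n (fraction a b x≃a/b p^n∣a p∤b) = fraction a b x≃a/b (∣-trans (p^m∣p^n m≤n) p^n∣a) p∤b

  p^0∣ℚ^⁻ : ∀ m k → 1 ≤ m → m < p → p^ 0 ∣ℚ m ^⁻ k
  p^0∣ℚ^⁻ (suc m) k _ m<p = fraction (ℤ.+ 1) (ℕ.pred (suc m ^ k)) x≃1/m^k (1∣ 1) p∤m^k
    where
    instance
      m^k≢0 : ℕ.NonZero (suc m ^ k)
      m^k≢0 = ℕ.m^n≢0 (suc m) k
    x≃1/m^k : toℚᵘ (suc m ^⁻ k) ≃ᵘ mkℚᵘ (ℤ.+ 1) (ℕ.pred (suc m ^ k))
    x≃1/m^k = toℚᵘ-1/ (suc m ^ k)
      where
      toℚᵘ-1/ : ∀ d .{{_ : ℕ.NonZero d}} → toℚᵘ ((ℤ.+ 1) / d) ≃ᵘ mkℚᵘ (ℤ.+ 1) (ℕ.pred d)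
      toℚᵘ-1/ (suc d) = ℚ.toℚᵘ-fromℚᵘ (mkℚᵘ (ℤ.+ 1) d)
    p∤m^k : ¬ p ∣ suc (ℕ.pred (suc m ^ k))
    p∤m^k = subst (λ d → ¬ p ∣ d) (sym (ℕ.suc-pred (suc m ^ k))) (p∤m⇒p∤m^k k (p∤[1+m] m<p))

  ∣ℚ-sumBelow : ∀ {n} m (f : ℕ → ℚ) → (∀ j → j < m → p^ n ∣ℚ f j) → p^ n ∣ℚ sumBelow m f
  ∣ℚ-sumBelow {n} zero    f _      = subst (p^ n ∣ℚ_) (sym (sumBelow-empty f)) (p^n∣ℚ0 n)
  ∣ℚ-sumBelow {n} (suc m) f p^n∣f = subst (p^ n ∣ℚ_) (sym (sumBelow-suc m f))
    (∣ℚ-+ (∣ℚ-sumBelow m f (λ j j<m → p^n∣f j (ℕ.m<n⇒m<1+n j<m))) (p^n∣f m ℕ.≤-refl))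

  ∣ℚ-sumBetween : ∀ {n} a N (f : ℕ → ℚ) → (∀ m → a < m → m < N → p^ n ∣ℚ f m) → p^ n ∣ℚ sumBetween a N f
  ∣ℚ-sumBetween {n} a N f p^n∣f = subst (p^ n ∣ℚ_) (sym (sumBetween-as-sumBelow a N f))
    (∣ℚ-sumBelow (N ∸ suc a) _ (λ j j< → p^n∣f _ (s≤s (ℕ.m≤m+n a j)) (j<N∸[1+a]⇒1+a+j<N a N j j<)))

  ∣ℚ⇒reduced : ∀ {n} z → p^ n ∣ℚ z → p ^ n ∣ ℤ.∣ ↥ z ∣ × ¬ p ∣ ↧ₙ z
  ∣ℚ⇒reduced {n} (mkℚ num den num⊥den) (fraction a b z≃a/b p^n∣a p∤b) = p^n∣num , p∤den
    where
    num*b≡a*den : ℤ.∣ num ∣ ℕ.* suc b ≡ ℤ.∣ a ∣ ℕ.* suc den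
    num*b≡a*den = trans (sym (ℤ.abs-* num (ℤ.+ suc b))) (trans (cong ℤ.∣_∣ (ℚᵘ.drop-*≡* z≃a/b)) (ℤ.abs-* a (ℤ.+ suc den)))
    p^n∣num : p ^ n ∣ ℤ.∣ num ∣
    p^n∣num = p^n∣m*k⇒p^n∣m n (ℤ.∣ num ∣) (suc b) (subst (p ^ n ∣_) (sym num*b≡a*den) (∣m⇒∣m*n (suc den) p^n∣a)) p∤b
    p∤den : ¬ p ∣ suc den
    p∤den p∣den with euclidsLemma (ℤ.∣ num ∣) (suc b) p-prime (subst (p ∣_) (sym num*b≡a*den) (∣n⇒∣m*n (ℤ.∣ a ∣) p∣den))
    ... | inj₂ p∣b   = p∤b p∣b
    ... | inj₁ p∣num = ℕ.<⇒≢ 1<p (sym (Coprimality.recompute num⊥den (p∣num , p∣den)))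

  ∣ℚ-harmonicTail^ : ∀ e {m} (f : ℕ → ℚ) → (∀ x → 1 ≤ x → x < p → p^ m ∣ℚ f x) →
    ∀ n → 1 ≤ n → n < p → p^ m ∣ℚ harmonicTail^ p e f n
  ∣ℚ-harmonicTail^ zero    f p^m∣f n 1≤n n<p = p^m∣f n 1≤n n<p
  ∣ℚ-harmonicTail^ (suc e) f p^m∣f n 1≤n n<p = ∣ℚ-+
    (∣ℚ-* (p^0∣ℚ^⁻ n 1 1≤n n<p) (∣ℚ-harmonicTail^ e f p^m∣f n 1≤n n<p))
    (∣ℚ-sumBetween n p _ (λ m n<m m<p → let 1≤m = ℕ.≤-trans 1≤n (ℕ.<⇒≤ n<m) in
      ∣ℚ-* (p^0∣ℚ^⁻ m 1 1≤m m<p) (∣ℚ-harmonicTail^ e f p^m∣f m 1≤m m<p)))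

  p^0∣ℚ[p∸n]⁻¹ : ∀ n → 1 ≤ n → n < p → p^ 0 ∣ℚ (p ∸ n) ⁻¹
  p^0∣ℚ[p∸n]⁻¹ n 1≤n n<p = p^0∣ℚ^⁻ (p ∸ n) 1 (ℕ.m<n⇒0<n∸m n<p) (ℕ.∸-monoʳ-< {p} {n} {0} 1≤n (ℕ.<⇒≤ n<p))

  p^0∣ℚreflectedSum : ∀ k x → p^ 0 ∣ℚ reflectedSum p k x
  p^0∣ℚreflectedSum []       x = p^0∣ℚℕ 1
  p^0∣ℚreflectedSum (k₁ ∷ k) x = ∣ℚ-sumBetween x p _ (λ n x<n n<p → let 1≤n = ℕ.<-≤-trans (s≤s z≤n) x<n in
    ∣ℚ-* (p^0∣ℚ[p∸n]⁻¹ n 1≤n n<p) (∣ℚ-harmonicTail^ (ℕ.pred k₁) (reflectedSum p k) (λ y _ _ → p^0∣ℚreflectedSum k y) n 1≤n n<p))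

  p^0∣ℚsgn : ∀ r → p^ 0 ∣ℚ sgn r
  p^0∣ℚsgn zero    = p^0∣ℚℕ 1
  p^0∣ℚsgn (suc r) = ∣ℚ-neg (p^0∣ℚsgn r)

  partialSum≈reflectedSum-∷ : ∀ k₁ k a → 1 ≤ k₁ →
    (∀ M x → p^ M ∣ℚ partialSum M k x - sgn (length k) * reflectedSum p k x) →
    ∀ T → p^ T ∣ℚ partialSum T (k₁ ∷ k) a - sgn (length (k₁ ∷ k)) * reflectedSum p (k₁ ∷ k) a
  partialSum≈reflectedSum-∷ k₁ k a 1≤k₁ p^M∣error T = subst (p^ T ∣ℚ_) (sym (partialSum-∷-error T))
    (∣ℚ-+ (∣ℚ-sumBelow T (λ j → N^ j * E T j)
            (λ j j<T → subst (λ t → p^ t ∣ℚ N^ j * E T j) (ℕ.m+[n∸m]≡n (ℕ.<⇒≤ j<T)) (∣ℚ-* (p^i∣ℚp^i j) (p^[T∸j]∣ℚE j))))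
          (∣ℚ-* (p^0∣ℚsgn (length k)) (∣ℚ-sumBetween a p _ p^T∣ℚmain)))
    where
    open Cons k₁ k a 1≤k₁
    p^[T∸j]∣ℚE : ∀ j → p^ (T ∸ j) ∣ℚ E T j
    p^[T∸j]∣ℚE j = ∣ℚ-sumBetween a p _ (λ n a<n n<p → let 1≤n = ℕ.<-≤-trans (s≤s z≤n) a<n in
      ∣ℚ-* (p^0∣ℚ^⁻ n (suc j) 1≤n n<p) (∣ℚ-harmonicTail^ e (error (T ∸ j)) (λ x _ _ → p^M∣error (T ∸ j) x) n 1≤n n<p))
    p^T∣ℚmain : ∀ n → a < n → n < p → p^ T ∣ℚ ((N^ T * n ^⁻ T) * (p ∸ n) ⁻¹) * W n
    p^T∣ℚmain n a<n n<p = let 1≤n = ℕ.<-≤-trans (s≤s z≤n) a<n in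
      ∣ℚ-*ʳ (∣ℚ-*ʳ (∣ℚ-*ʳ (p^i∣ℚp^i T) (p^0∣ℚ^⁻ n T 1≤n n<p)) (p^0∣ℚ[p∸n]⁻¹ n 1≤n n<p))
            (∣ℚ-harmonicTail^ e (reflectedSum p k) (λ y _ _ → p^0∣ℚreflectedSum k y) n 1≤n n<p)

  partialSum≈reflectedSum : ∀ k → All (1 ≤_) k → ∀ T a →
    p^ T ∣ℚ partialSum T k a - sgn (length k) * reflectedSum p k a
  partialSum≈reflectedSum []       _             zero    a =
    ∣ℚ-- (subst (p^ 0 ∣ℚ_) (sym (sumBelow-empty _)) (p^n∣ℚ0 0)) (p^0∣ℚℕ 1)
  partialSum≈reflectedSum []       _             (suc T) a =
    subst (p^ suc T ∣ℚ_) (sym (cong (_- 1ℚ * 1ℚ) (partialSum-[] T a))) (p^n∣ℚ0 (suc T))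
  partialSum≈reflectedSum (k₁ ∷ k) (1≤k₁ ∷ 1≤k) T a =
    partialSum≈reflectedSum-∷ k₁ k a 1≤k₁ (partialSum≈reflectedSum k 1≤k) T

  ζ<≈partialRHS : ∀ k₁ k → All (1 ≤_) (k₁ ∷ k) → ∀ T → p^ T ∣ℚ ζ< p (k₁ ∷ k) - partialRHS p (k₁ ∷ k) T
  ζ<≈partialRHS k₁ k k-pos T = subst (p^ T ∣ℚ_) error≡ζ<-partialRHS
    (∣ℚ-* (∣ℚ-neg (p^0∣ℚsgn (length (k₁ ∷ k)))) (partialSum≈reflectedSum (k₁ ∷ k) k-pos T 0))
    where
    open ≡-Reasoning
    σ F S : ℚ
    σ = sgn (length (k₁ ∷ k))
    F = partialSum T (k₁ ∷ k) 0
    S = reflectedSum p (k₁ ∷ k) 0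
    error≡ζ<-partialRHS : (- σ) * (F - σ * S) ≡ ζ< p (k₁ ∷ k) - partialRHS p (k₁ ∷ k) T
    error≡ζ<-partialRHS = begin
      (- σ) * (F - σ * S)    ≡⟨ solve 3 (λ σ F S → (:- σ) :* (F :- σ :* S) := (σ :* σ) :* S :- σ :* F) refl σ F S ⟩
      (σ * σ) * S - σ * F    ≡⟨ cong (λ x → x * S - σ * F) (sgn-*-sgn (length (k₁ ∷ k))) ⟩
      1ℚ * S - σ * F         ≡⟨ cong₂ _-_ (trans (ℚ.*-identityˡ S) (sym (Connector.ζ<≡reflectedSum p k₁ k k-pos (ℕ.<-trans (s≤s z≤n) 1<p))))
                                         (cong (σ *_) (sym (sumOver-upTo T (λ i → coeff p (k₁ ∷ k) i * ℕ→ℚ (p ^ i))))) ⟩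
      ζ< p (k₁ ∷ k) - partialRHS p (k₁ ∷ k) T ∎

theorem5p3 : (k : Index) → ¬ (k ≡ []) → All (λ kᵢ → 1 ≤ kᵢ) k →
    (n : ℕ) → 1 ≤ n →
    Σ ℕ (λ N₀ → (N : ℕ) → N₀ ≤ N →
      Σ ℕ (λ P → (p : ℕ) → Prime p → P < p →
        CongMod p n (ζ< p k) (partialRHS p k N)))
theorem5p3 []       k≢[] _     n _ = ⊥-elim (k≢[] refl)
theorem5p3 (k₁ ∷ k) _    k-pos n _ = n , λ T n≤T → 0 , λ p p-prime _ → let open PAdic p p-prime in
  ∣ℚ⇒reduced _ (∣ℚ-weaken n≤T (ζ<≈partialRHS k₁ k k-pos T))
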